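{- Let $q$ be a prime power and $m\geq 2$, $h\geq 1$, $n\geq h+1$ integers. Let $\mathcal{C}_1,\dots,\mathcal{C}_m\subseteq\mathbb{F}_{q^n}^n$ be $[n,h+1,n-h]_{q^n/q}$ MRD codes and let $\mathcal{C}:=\bigoplus_{i=1}^m\mathcal{C}_i=\{(u_1\mid u_2\mid\cdots\mid u_m): u_i\in\mathcal{C}_i\}\subseteq\mathbb{F}_{q^n}^{mn}$. Then $\mathcal{C}$ is an $[mn,m(h+1),n-h]_{q^n/q}$ code whose generalized rank weights satisfy $$d_i(\mathcal{C})=n-h-1+i\ \ (1\leq i\leq h+1),\qquad d_{m(h+1)-i}(\mathcal{C})=mn-i\ \ (0\leq i\leq h),\qquad d_{(m-1)(h+1)}(\mathcal{C})=(m-1)n.$$ Moreover, if $m>2$, then $n+1\leq d_{h+2}(\mathcal{C})<d_{h+3}(\mathcal{C})<\cdots<d_{(m-1)(h+1)-1}(\mathcal{C})\leq(m-1)n-1$, and $d_{k(h+1)}(\mathcal{C})\leq kn$ for every $k=1,\dots,m-1$.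
   Context: For $v=(v_1,\dots,v_t)\in\mathbb{F}_{q^n}^t$, the rank weight is $\omega_{\mathrm{rk}}(v)=\dim_{\mathbb{F}_q}\langle v_1,\dots,v_t\rangle_{\mathbb{F}_q}$. An $[t,k,d]_{q^n/q}$ code is a $k$-dimensional $\mathbb{F}_{q^n}$-subspace of $\mathbb{F}_{q^n}^t$ whose minimum nonzero rank weight is $d$; it is MRD if $nk=\min\{n(t-d+1),t(n-d+1)\}$. For a non-degenerate $[t,k]_{q^n/q}$ code $\mathcal{C}$ with generator matrix $G$ (a $k\times t$ matrix over $\mathbb{F}_{q^n}$ whose columns are $\mathbb{F}_q$-linearly independent), the $\mathbb{F}_q$-span $U\subseteq\mathbb{F}_{q^n}^k$ of the columns of $G$ is an associated $q$-system, and for $1\leq\rho\leq k$ the $\rho$-th generalized rank weight of $\mathcal{C}$ is $d_\rho(\mathcal{C})=t-\max\{\dim_{\mathbb{F}_q}(U\cap H): H\subseteq\mathbb{F}_{q^n}^k \text{ an }\mathbb{F}_{q^n}\text{ -subspace with }\dim_{\mathbb{F}_{q^n}}H=k-\rho\}$ (independent of the choice of $G$); $d_1(\mathcal{C})$ is the minimum distance. -}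

module Defs where

open import Level using (0ℓ)
open import Data.Nat using (ℕ; zero; suc; _≤_)
import Data.Nat as N
open import Data.Nat.Primality using (Prime)
open import Data.Fin using (Fin; combine)
import Data.Fin
open import Data.Product using (Σ; ∃; _×_; _,_)
open import Data.Unit using (⊤)
open import Relation.Nullary using (¬_)
open import Relation.Binary.PropositionalEquality using (_≡_)
open import Algebra.Bundles using (CommutativeRing)

record Field : Set₁ where
  field
    ring : CommutativeRing 0ℓ 0ℓ
  open CommutativeRing ring public hiding (ring)
  field
    0≉1     : ¬ (0# ≈ 1#)
    inverse : ∀ x → ¬ (x ≈ 0#) → ∃ λ y → x * y ≈ 1#

IsPrimePower : ℕ → Set
IsPrimePower q = ∃ λ p → ∃ λ e → Prime p × 1 ≤ e × q ≡ p N.^ e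

module _ (L : Field) where
  open Field L

  V : ℕ → Set
  V t = Fin t → Carrier

  0V : ∀ {t} → V t
  0V _ = 0#

  _+V_ : ∀ {t} → V t → V t → V t
  (x +V y) j = x j + y j

  _·V_ : ∀ {t} → Carrier → V t → V t
  (a ·V x) j = a * x j

  _≈V_ : ∀ {t} → V t → V t → Set
  x ≈V y = ∀ j → x j ≈ y j

  NonZeroV : ∀ {t} → V t → Set
  NonZeroV x = ¬ (x ≈V 0V)

  lincomb : ∀ {k t} → (Fin k → Carrier) → (Fin k → V t) → V t
  lincomb {zero}  c v = 0V
  lincomb {suc k} c v = (c Data.Fin.zero ·V v Data.Fin.zero) +V lincomb (λ i → c (Data.Fin.suc i)) (λ i → v (Data.Fin.suc i))
    
  -- A "scalar domain" S ⊆ L : S = everything (L-linear algebra) or the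
  -- subfield F_q (F_q-linear algebra).
  Scalars : Set₁
  Scalars = Carrier → Set

  All : Scalars
  All _ = ⊤

  InSpan : ∀ {k t} → Scalars → (Fin k → V t) → V t → Set
  InSpan S v x = ∃ λ c → (∀ i → S (c i)) × (x ≈V lincomb c v)

  Independent : ∀ {k t} → Scalars → (Fin k → V t) → Set
  Independent S v = ∀ c → (∀ i → S (c i)) → lincomb c v ≈V 0V → ∀ i → c i ≈ 0#

  record IsSubspace {t} (S : Scalars) (W : V t → Set) : Set where
    field
      resp  : ∀ {x y} → x ≈V y → W x → W y
      zero∈ : W 0V
      +∈    : ∀ {x y} → W x → W y → W (x +V y)
      ·∈    : ∀ {a x} → S a → W x → W (a ·V x)

  HasDim : ∀ {t} → Scalars → (V t → Set) → ℕ → Set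
  HasDim S W d = Σ (Fin d → V _) λ b →
    (∀ i → W (b i)) × Independent S b × (∀ x → W x → InSpan S b x)

  record IsSubfield (K : Scalars) : Set where
    field
      resp : ∀ {x y} → x ≈ y → K x → K y
      0∈   : K 0#
      1∈   : K 1#
      +∈   : ∀ {x y} → K x → K y → K (x + y)
      -∈   : ∀ {x} → K x → K (- x)
      *∈   : ∀ {x y} → K x → K y → K (x * y)
      inv∈ : ∀ {x y} → K x → x * y ≈ 1# → K y

  HasCard : Scalars → ℕ → Set
  HasCard K q = Σ (Fin q → Carrier) λ e →
    (∀ i → K (e i)) × (∀ i j → e i ≈ e j → i ≡ j) × (∀ x → K x → ∃ λ i → e i ≈ x)

  -- (L, K) is a model of F_{q^n}/F_q: K a subfield with q elements and
  -- L of dimension n over K (so |L| = q^n).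
  record IsExtension (K : Scalars) (q n : ℕ) : Set where
    field
      subfield : IsSubfield K
      cardK    : HasCard K q
      degree   : HasDim K (λ (_ : V 1) → ⊤) n

  module _ (K : Scalars) where

    -- rank weight: ω_rk(v) = dim_{F_q} ⟨v_1,…,v_t⟩_{F_q}; the entries
    -- v_j ∈ L are regarded as elements of L^1.
    RankWeight : ∀ {t} → V t → ℕ → Set
    RankWeight {t} v r = HasDim K (InSpan K (λ (j : Fin t) (_ : Fin 1) → v j)) r

    IsCode : ∀ {t} → (V t → Set) → ℕ → Set
    IsCode C k = IsSubspace All C × HasDim All C k

    MinDist : ∀ {t} → (V t → Set) → ℕ → Set
    MinDist C d =
      (∃ λ x → C x × NonZeroV x × RankWeight x d) ×
      (∀ x r → C x → NonZeroV x → RankWeight x r → d ≤ r)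

    IsCodeP : ∀ {t} → (V t → Set) → ℕ → ℕ → Set
    IsCodeP C k d = IsCode C k × MinDist C d

    IsMRD : ∀ {t} → ℕ → (V t → Set) → ℕ → ℕ → Set
    IsMRD {t} n C k d = IsCodeP C k d × (n N.* k ≡ (n N.* (t N.∸ d N.+ 1)) N.⊓ (t N.* (n N.∸ d N.+ 1)))

    -- G (k×t, rows G i) is a generator matrix of the code C: rows are
    -- L-independent and span C; and its columns are F_q-independent
    -- (non-degeneracy).
    IsGenMatrix : ∀ {t k} → (V t → Set) → (Fin k → V t) → Set
    IsGenMatrix {t} {k} C G =
      Independent All G × (∀ x → C x → InSpan All G x) × (∀ x → InSpan All G x → C x) ×
      Independent K (λ (j : Fin t) (i : Fin k) → G i j)

    QSystem : ∀ {t k} → (Fin k → V t) → V k → Set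
    QSystem {t} {k} G = InSpan K (λ (j : Fin t) (i : Fin k) → G i j)

    -- d_ρ(C) = w : for a generator matrix G with q-system U,
    -- w = t - max{ dim_{F_q}(U ∩ H) : H ⊆ L^k L-subspace, dim_L H = k - ρ }.
    -- (stated as: the maximum equals t - w, i.e. max + w = t)
    GRW : ∀ {t} → (V t → Set) → ℕ → ℕ → ℕ → Set₁
    GRW {t} C k ρ w = Σ (Fin k → V t) λ G → IsGenMatrix C G ×
      ( (∃ λ (H : V k → Set) → IsSubspace All H × HasDim All H (k N.∸ ρ) ×
           ∃ λ e → HasDim K (λ x → QSystem G x × H x) e × e N.+ w ≡ t)
      × (∀ (H : V k → Set) → IsSubspace All H → HasDim All H (k N.∸ ρ) →
           ∀ e → HasDim K (λ x → QSystem G x × H x) e → e N.+ w ≤ t))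

  DirectSum : ∀ {m n} → (Fin m → V n → Set) → V (m N.* n) → Set
  DirectSum {m} {n} Cs x = ∀ (i : Fin m) → Cs i (λ j → x (combine i j))

module Submission where

-- Let U be the q-system of C = ⊕ Cᵢ and k = m(h+1).  Then d_ρ = mn − E(k − ρ), where E(δ) is the
-- largest F_q-dimension of U ∩ H over L-subspaces H ⊆ L^k of dimension δ, and:
--   * E grows strictly with δ: a column of the generator matrix outside H can be adjoined to H;
--   * E(δ) + (k − 1 − δ) + (n − h) ≤ mn: enlarge H to a hyperplane a⊥; then U ∩ a⊥ is the kernel
--     of u ↦ a·u on U, whose image is spanned by the entries of the codeword aG, of rank ≥ n − h;
--   * E(δ) ≤ δ for δ ≤ h and E(h + 1) ≤ n: project H onto the first block, where the previous
--     bound for a single MRD block gives dim(U₁ ∩ H₁) ≤ dim H₁, and induct on the blocks;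
--   * E((m − s)(h + 1)) ≥ (m − s)n, witnessed by the vectors vanishing on the first s blocks.
-- Everything is constructive because F_q is finite: spans, independence and the maxima E(δ)
-- are decided by exhaustive search over coordinates.

open import Defs
import Data.Nat
open import Data.Nat as ℕ using (ℕ; zero; suc; _≤_; _<_; z≤n; s≤s; _∸_)
import Data.Nat.Properties as ℕ
open import Data.Nat.Solver using (module +-*-Solver)
open import Data.Fin as Fin using (Fin; zero; suc; _↑ˡ_; _↑ʳ_; splitAt; punchIn; punchOut; inject≤)
open import Data.Fin.Properties using (any?; all?; join-splitAt; punchIn-punchOut; combine-surjective)
open import Data.Vec.Functional using (Vector; _∷_; _++_; take; drop; insertAt; removeAt; transpose)
open import Data.Vec.Functional.Properties using (lookup-++ˡ; lookup-++ʳ; insertAt-lookup; insertAt-punchIn)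
open import Data.Vec.Functional.Relation.Unary.All.Properties using (++⁺)
open import Data.Sum using (_⊎_; inj₁; inj₂; [_,_]′)
open import Data.Product using (∃; ∃₂; _×_; _,_; proj₁; proj₂)
open import Data.Unit using (⊤; tt)
open import Data.Empty using (⊥-elim)
open import Function using (_∘_)
open import Relation.Nullary using (¬_; Dec; yes; no)
open import Relation.Nullary.Decidable using (map′; ¬?; _×-dec_; decidable-stable)
open import Relation.Unary using (_∩_)
open import Relation.Binary.PropositionalEquality as ≡ using (_≡_)
open import Algebra.Bundles using (CommutativeRing)
import Algebra.Properties.Ring as RingProperties
import Algebra.Properties.Semiring.Sum as SumProperties
import Algebra.Properties.CommutativeSemigroup as CommutativeSemigroupProperties
import Relation.Binary.Reasoning.Setoid as SetoidReasoning

module Arithmetic where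
  open Data.Nat using (_+_; _*_)
  open +-*-Solver

  l+[n∸m]+[o∸n]≤o⇒l≤m : ∀ {l m n o} → m ≤ n → n ≤ o → l + (n ∸ m) + (o ∸ n) ≤ o → l ≤ m
  l+[n∸m]+[o∸n]≤o⇒l≤m {l} {m} m≤n n≤o bound with ℕ.m≤n⇒∃[o]m+o≡n m≤n | ℕ.m≤n⇒∃[o]m+o≡n n≤o
  ... | a , ≡.refl | b , ≡.refl rewrite ℕ.m+n∸m≡n m a | ℕ.m+n∸m≡n (m + a) b =
    ℕ.+-cancelʳ-≤ a l m (ℕ.+-cancelʳ-≤ b (l + a) (m + a) bound)

  [o∸n]+[n∸m]≡o∸m : ∀ {m n o} → m ≤ n → n ≤ o → (o ∸ n) + (n ∸ m) ≡ o ∸ m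
  [o∸n]+[n∸m]≡o∸m {m} m≤n n≤o with ℕ.m≤n⇒∃[o]m+o≡n m≤n | ℕ.m≤n⇒∃[o]m+o≡n n≤o
  ... | a , ≡.refl | b , ≡.refl rewrite ℕ.m+n∸m≡n (m + a) b | ℕ.m+n∸m≡n m a | ℕ.+-assoc m a b | ℕ.m+n∸m≡n m (a + b) =
    ℕ.+-comm b a

  m∸n≡1+[m∸[1+n]] : ∀ {m n} → n < m → m ∸ n ≡ suc (m ∸ suc n)
  m∸n≡1+[m∸[1+n]] {suc m} n<m = ℕ.+-∸-assoc 1 (ℕ.≤-pred n<m)

  1+m∸n+[n∸1]≡m : ∀ {m n} → 1 ≤ n → n ≤ suc m → (suc m ∸ n) + (n ∸ 1) ≡ m
  1+m∸n+[n∸1]≡m {n = suc n} _ (s≤s n≤m) = ℕ.m∸n+n≡m n≤m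

  1+m∸m≡1 : ∀ m → suc m ∸ m ≡ 1
  1+m∸m≡1 zero    = ≡.refl
  1+m∸m≡1 (suc m) = 1+m∸m≡1 m

  1+m+n∸m≡1+n : ∀ m n → suc (m + n) ∸ m ≡ suc n
  1+m+n∸m≡1+n m n = ≡.trans (ℕ.+-∸-assoc 1 (ℕ.m≤m+n m n)) (≡.cong suc (ℕ.m+n∸m≡n m n))

  m+n∸[n∸1]≡1+m : ∀ m {n} → 1 ≤ n → (m + n) ∸ (n ∸ 1) ≡ suc m
  m+n∸[n∸1]≡1+m m {suc n} _ rewrite ℕ.+-suc m n | ℕ.+-comm m n = 1+m+n∸m≡1+n n m

  two-block-bound : ∀ {h t} p r {a b} → suc h ≤ t → p + r ≡ suc h →
    (r ≤ h → a ≤ r) → a ≤ t → (p ≤ h → b ≤ p) → (p ≡ suc h → b ≤ t) → b + a ≤ t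
  two-block-bound zero r h<t p+r≡ a≤r a≤t b≤p b≤t = ℕ.+-mono-≤ (b≤p z≤n) a≤t
  two-block-bound {t = t} (suc p) zero h<t p+r≡ a≤r a≤t b≤p b≤t =
    ≡.subst (_ ≤_) (ℕ.+-identityʳ t) (ℕ.+-mono-≤ (b≤t (≡.trans (≡.sym (ℕ.+-identityʳ (suc p))) p+r≡)) (a≤r z≤n))
  two-block-bound {h} {t} (suc p) (suc r) h<t p+r≡ a≤r a≤t b≤p b≤t =
    ℕ.≤-trans (ℕ.+-mono-≤ (b≤p p<h) (a≤r r<h)) (≡.subst (_≤ t) (≡.sym p+r≡) h<t)
    where
    p+r≡h : p + suc r ≡ h
    p+r≡h = ℕ.suc-injective p+r≡
    p<h : suc p ≤ h
    p<h = ≡.subst (suc p ≤_) (≡.trans (≡.sym (ℕ.+-suc p r)) p+r≡h) (s≤s (ℕ.m≤m+n p r))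
    r<h : suc r ≤ h
    r<h = ≡.subst (suc r ≤_) p+r≡h (ℕ.m≤n+m (suc r) p)

  -- In the following E is a maximal dimension of U ∩ H and w = t - E the generalized weight.

  low-weight : ∀ {n h i X E} → suc h ≤ n → i ≤ h → X + (h ∸ i) ≤ E → E + i + (n ∸ h) ≤ n + X →
    E + (n ∸ h ∸ 1 + suc i) ≡ n + X
  low-weight {n} {h} {i} {X} {E} h<n i≤h lower upper with ℕ.m≤n⇒∃[o]m+o≡n i≤h | ℕ.m≤n⇒∃[o]m+o≡n h<n
  ... | a , ≡.refl | f , ≡.refl rewrite 1+m+n∸m≡1+n (i + a) f | ℕ.m+n∸m≡n i a =
    ≡.trans (≡.cong (_+ (f + suc i)) E≡X+a)
      (solve 4 (λ X a i f → (X :+ a) :+ (f :+ (con 1 :+ i)) := con 1 :+ (i :+ a :+ f) :+ X) ≡.refl X a i f)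
    where
    E≡X+a : E ≡ X + a
    E≡X+a = ℕ.≤-antisym
      (ℕ.+-cancelʳ-≤ (i + suc f) E (X + a) (≡.subst₂ _≤_ (ℕ.+-assoc E i (suc f))
        (solve 4 (λ X a i f → con 1 :+ (i :+ a :+ f) :+ X := (X :+ a) :+ (i :+ (con 1 :+ f))) ≡.refl X a i f) upper))
      lower

  weight-above : ∀ {E w t h n} → E + w ≡ t → E + suc h + (n ∸ h) ≤ t → h ≤ n → n + 1 ≤ w
  weight-above {E} {w} {t} {h} {n} E+w≡t bound h≤n =
    ℕ.+-cancelˡ-≤ E (n + 1) w (≡.subst₂ _≤_ E+1+h+[n∸h]≡E+[n+1] (≡.sym E+w≡t) bound)
    where
    E+1+h+[n∸h]≡E+[n+1] : E + suc h + (n ∸ h) ≡ E + (n + 1)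
    E+1+h+[n∸h]≡E+[n+1] = ≡.trans (ℕ.+-assoc E (suc h) (n ∸ h))
      (≡.cong (E +_) (≡.trans (≡.cong suc (ℕ.m+[n∸m]≡n h≤n)) (ℕ.+-comm 1 n)))

  weight-increases : ∀ {E₁ E₂ w₁ w₂ t} → E₁ + w₁ ≡ t → E₂ + w₂ ≡ t → suc E₂ ≤ E₁ → w₁ < w₂
  weight-increases {E₁} {E₂} {w₁} {w₂} E₁+w₁≡t E₂+w₂≡t E₂<E₁ = ℕ.+-cancelˡ-≤ E₂ (suc w₁) w₂
    (≡.subst₂ _≤_ (≡.sym (ℕ.+-suc E₂ w₁)) (≡.trans E₁+w₁≡t (≡.sym E₂+w₂≡t)) (ℕ.+-monoˡ-≤ w₁ E₂<E₁))

  weight-below-pred : ∀ {E w n X} → E + w ≡ n + X → suc n ≤ E → w ≤ X ∸ 1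
  weight-below-pred {E} {w} {n} {X} E+w≡n+X n<E with ℕ.m≤n⇒∃[o]m+o≡n n<E
  ... | e , ≡.refl = ≡.subst (λ Y → w ≤ Y ∸ 1) 1+e+w≡X (ℕ.m≤n+m w e)
    where
    1+e+w≡X : suc (e + w) ≡ X
    1+e+w≡X = ℕ.+-cancelˡ-≡ n (suc (e + w)) X
      (≡.trans (ℕ.+-suc n (e + w)) (≡.trans (≡.cong suc (≡.sym (ℕ.+-assoc n e w))) E+w≡n+X))

  weight-below : ∀ {m n j E w} → E + w ≡ m * n → (m ∸ j) * n ≤ E → j ≤ m → w ≤ j * n
  weight-below {m} {n} {j} {E} {w} E+w≡m*n lower j≤m = ℕ.+-cancelˡ-≤ ((m ∸ j) * n) w (j * n)
    (≡.subst ((m ∸ j) * n + w ≤_) (≡.sym split) (ℕ.≤-trans (ℕ.+-monoˡ-≤ w lower) (ℕ.≤-reflexive E+w≡m*n)))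
    where
    split : (m ∸ j) * n + j * n ≡ m * n
    split = ≡.trans (≡.sym (ℕ.*-distribʳ-+ n (m ∸ j) j)) (≡.cong (_* n) (ℕ.m∸n+n≡m j≤m))

Searchable : (A : Set) → (A → A → Set) → (A → Set) → Set₁
Searchable A _∼_ P = (Q : A → Set) → (∀ {x y} → x ∼ y → Q x → Q y) → (∀ x → Dec (Q x)) →
  Dec (∃ λ x → P x × Q x)

module _ {A : Set} {_∼_ : A → A → Set} {P : A → Set} (∼-refl : ∀ {x} → x ∼ x) where

  private
    _≋_ : ∀ {d} → Vector A d → Vector A d → Set
    f ≋ g = ∀ i → f i ∼ g i

    ∷-cong : ∀ {d x y} {f g : Vector A d} → x ∼ y → f ≋ g → (x ∷ f) ≋ (y ∷ g)
    ∷-cong x∼y f≋g zero    = x∼y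
    ∷-cong x∼y f≋g (suc i) = f≋g i

    ∷-all : ∀ {d x} {f : Vector A d} → P x → (∀ i → P (f i)) → ∀ i → P ((x ∷ f) i)
    ∷-all px pf zero    = px
    ∷-all px pf (suc i) = pf i

    ∷-η : ∀ {d} (f : Vector A (suc d)) → f ≋ (f zero ∷ f ∘ suc)
    ∷-η f zero    = ∼-refl
    ∷-η f (suc i) = ∼-refl

  searchable-Vector : Searchable A _∼_ P → ∀ d → Searchable (Vector A d) _≋_ (λ f → ∀ i → P (f i))
  searchable-Vector search zero Q resp Q? with Q? (λ ())
  ... | yes q = yes ((λ ()) , (λ ()) , q)
  ... | no ¬q = no (λ { (f , _ , qf) → ¬q (resp (λ ()) qf) })
  searchable-Vector search (suc d) Q resp Q? =
    map′ to from (search Q′ resp′ (λ x → searchable-Vector search d (Q ∘ (x ∷_)) (resp ∘ ∷-cong ∼-refl) (Q? ∘ (x ∷_))))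
    where
    Q′ : A → Set
    Q′ x = ∃ λ f → (∀ i → P (f i)) × Q (x ∷ f)
    resp′ : ∀ {x y} → x ∼ y → Q′ x → Q′ y
    resp′ x∼y (f , pf , qf) = f , pf , resp (∷-cong x∼y (λ _ → ∼-refl)) qf
    to : (∃ λ x → P x × Q′ x) → ∃ λ f → (∀ i → P (f i)) × Q f
    to (x , px , f , pf , qf) = x ∷ f , ∷-all px pf , qf
    from : (∃ λ f → (∀ i → P (f i)) × Q f) → ∃ λ x → P x × Q′ x
    from (f , pf , qf) = f zero , pf zero , f ∘ suc , pf ∘ suc , resp (∷-η f) qf

bounded-maximum : (Q : ℕ → Set) → (∀ e → Dec (Q e)) → Q 0 → ∀ t → (∀ e → Q e → e ≤ t) →
  ∃ λ E → Q E × (∀ e → Q e → e ≤ E)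
bounded-maximum Q Q? q0 zero    bound = 0 , q0 , bound
bounded-maximum Q Q? q0 (suc t) bound with Q? (suc t)
... | yes qt = suc t , qt , bound
... | no ¬qt = bounded-maximum Q Q? q0 t
  (λ e qe → ℕ.≤-pred (ℕ.≤∧≢⇒< (bound e qe) (λ e≡ → ¬qt (≡.subst Q e≡ qe))))

↑-elim : ∀ {p r} (Q : Fin (p ℕ.+ r) → Set) → (∀ a → Q (a ↑ˡ r)) → (∀ a → Q (p ↑ʳ a)) → ∀ i → Q i
↑-elim {p} {r} Q left right i with splitAt p i | join-splitAt p r i
... | inj₁ a | eq = ≡.subst Q eq (left a)
... | inj₂ a | eq = ≡.subst Q eq (right a)

All-∷ : ∀ {A : Set} {P : A → Set} {d x} {f : Fin d → A} → P x → (∀ i → P (f i)) → ∀ i → P ((x ∷ f) i)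
All-∷ px pf zero    = px
All-∷ px pf (suc i) = pf i

module Vectors (L : Field) where
  open Field L public hiding (zero)
  open RingProperties (CommutativeRing.ring ring) public
    using (-‿distribˡ-*; -‿distribʳ-*; -1*x≈-x; +-inverseˡ-unique; x∙y⁻¹≈ε⇒x≈y)
  open SumProperties semiring public
    using (sum; sum-cong-≋; sum-replicate-zero; sum-remove; ∑-distrib-+; ∑-comm; *-distribˡ-sum; *-distribʳ-sum)
  open CommutativeSemigroupProperties *-commutativeSemigroup public using () renaming (x∙yz≈y∙xz to x*yz≈y*xz)
  open SetoidReasoning setoid public

  Vec : ℕ → Set
  Vec = V L

  infixl 6 _+v_
  infixr 7 _·v_
  infix  4 _≈v_

  _+v_ : ∀ {t} → Vec t → Vec t → Vec t
  _+v_ = _+V_ L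

  _·v_ : ∀ {t} → Carrier → Vec t → Vec t
  _·v_ = _·V_ L

  _≈v_ : ∀ {t} → Vec t → Vec t → Set
  _≈v_ = _≈V_ L

  0v : ∀ {t} → Vec t
  0v = 0V L

  -v_ : ∀ {t} → Vec t → Vec t
  (-v x) j = - x j

  lc : ∀ {k t} → (Fin k → Carrier) → (Fin k → Vec t) → Vec t
  lc = lincomb L

  ≈v-refl : ∀ {t} {x : Vec t} → x ≈v x
  ≈v-refl j = refl

  ≈v-sym : ∀ {t} {x y : Vec t} → x ≈v y → y ≈v x
  ≈v-sym p j = sym (p j)

  ≈v-trans : ∀ {t} {x y z : Vec t} → x ≈v y → y ≈v z → x ≈v z
  ≈v-trans p q j = trans (p j) (q j)

  ≡⇒≈ : ∀ {x y} → x ≡ y → x ≈ y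
  ≡⇒≈ ≡.refl = refl

  ≡⇒≈v : ∀ {t} {x y : Vec t} → x ≡ y → x ≈v y
  ≡⇒≈v ≡.refl = ≈v-refl

  -v≈-1·v : ∀ {t} (x : Vec t) → -v x ≈v (- 1#) ·v x
  -v≈-1·v x j = sym (-1*x≈-x (x j))

  isolate : ∀ {c x r y} → c * x + r ≈ 0# → c * y ≈ 1# → x ≈ - y * r
  isolate {c} {x} {r} {y} cx+r≈0 cy≈1 = begin
    x            ≈⟨ sym (*-identityˡ x) ⟩
    1# * x       ≈⟨ *-congʳ (sym (trans (*-comm y c) cy≈1)) ⟩
    y * c * x    ≈⟨ *-assoc y c x ⟩
    y * (c * x)  ≈⟨ *-congˡ (+-inverseˡ-unique _ _ cx+r≈0) ⟩
    y * - r      ≈⟨ sym (-‿distribʳ-* y r) ⟩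
    - (y * r)    ≈⟨ -‿distribˡ-* y r ⟩
    - y * r      ∎

  sum-cong : ∀ {k} {f g : Fin k → Carrier} → (∀ i → f i ≈ g i) → sum f ≈ sum g
  sum-cong {k} {f} {g} = sum-cong-≋ {k} {f} {g}

  sum-zero : ∀ {k} {f : Fin k → Carrier} → (∀ i → f i ≈ 0#) → sum f ≈ 0#
  sum-zero {k} f≈0 = trans (sum-cong {k} f≈0) (sum-replicate-zero k)

  unit : ∀ {k} → Fin k → Fin k → Carrier
  unit zero    zero    = 1#
  unit zero    (suc j) = 0#
  unit (suc i) zero    = 0#
  unit (suc i) (suc j) = unit i j

  sum-unitˡ : ∀ {k} (i : Fin k) (f : Fin k → Carrier) → sum (λ j → unit i j * f j) ≈ f i
  sum-unitˡ {suc k} zero    f = trans (+-cong (*-identityˡ _) (sum-zero {k} (λ j → zeroˡ _))) (+-identityʳ _)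
  sum-unitˡ {suc k} (suc i) f = trans (+-cong (zeroˡ _) (sum-unitˡ i (f ∘ suc))) (+-identityˡ _)

  sum-unitʳ : ∀ {k} (i : Fin k) (f : Fin k → Carrier) → sum (λ j → f j * unit j i) ≈ f i
  sum-unitʳ {suc k} zero    f = trans (+-cong (*-identityʳ _) (sum-zero {k} (λ j → zeroʳ _))) (+-identityʳ _)
  sum-unitʳ {suc k} (suc i) f = trans (+-cong (zeroʳ _) (sum-unitʳ i (f ∘ suc))) (+-identityˡ _)

  lc-sum : ∀ {k t} (c : Fin k → Carrier) (v : Fin k → Vec t) j → lc c v j ≈ sum (λ i → c i * v i j)
  lc-sum {zero}  c v j = refl
  lc-sum {suc k} c v j = +-congˡ (lc-sum (c ∘ suc) (v ∘ suc) j)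

  lc-cong : ∀ {k t} {c c′ : Fin k → Carrier} {v v′ : Fin k → Vec t} →
    (∀ i → c i ≈ c′ i) → (∀ i → v i ≈v v′ i) → lc c v ≈v lc c′ v′
  lc-cong {zero}  c≈ v≈ j = refl
  lc-cong {suc k} c≈ v≈ j = +-cong (*-cong (c≈ zero) (v≈ zero j)) (lc-cong (c≈ ∘ suc) (v≈ ∘ suc) j)

  lc-congˡ : ∀ {k t} {c c′ : Fin k → Carrier} {v : Fin k → Vec t} → (∀ i → c i ≈ c′ i) → lc c v ≈v lc c′ v
  lc-congˡ c≈ = lc-cong c≈ (λ _ → ≈v-refl)

  lc-congʳ : ∀ {k t} {c : Fin k → Carrier} {v v′ : Fin k → Vec t} → (∀ i → v i ≈v v′ i) → lc c v ≈v lc c v′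
  lc-congʳ v≈ = lc-cong (λ _ → refl) v≈

  lc-zeroˡ : ∀ {k t} {c : Fin k → Carrier} (v : Fin k → Vec t) → (∀ i → c i ≈ 0#) → lc c v ≈v 0v
  lc-zeroˡ {k} v c≈0 j = trans (lc-sum _ v j) (sum-zero {k} (λ i → trans (*-congʳ (c≈0 i)) (zeroˡ _)))

  lc-zeroʳ : ∀ {k t} (c : Fin k → Carrier) {v : Fin k → Vec t} → (∀ i → v i ≈v 0v) → lc c v ≈v 0v
  lc-zeroʳ {k} c v≈0 j = trans (lc-sum c _ j) (sum-zero {k} (λ i → trans (*-congˡ (v≈0 i j)) (zeroʳ _)))

  lc-+ˡ : ∀ {k t} (c c′ : Fin k → Carrier) (v : Fin k → Vec t) → lc (λ i → c i + c′ i) v ≈v lc c v +v lc c′ v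
  lc-+ˡ {k} c c′ v j = begin
    lc (λ i → c i + c′ i) v j                            ≈⟨ lc-sum _ v j ⟩
    sum (λ i → (c i + c′ i) * v i j)                     ≈⟨ sum-cong {k} (λ i → distribʳ _ _ _) ⟩
    sum (λ i → c i * v i j + c′ i * v i j)               ≈⟨ ∑-distrib-+ {k} (λ i → c i * v i j) (λ i → c′ i * v i j) ⟩
    sum (λ i → c i * v i j) + sum (λ i → c′ i * v i j)   ≈⟨ sym (+-cong (lc-sum c v j) (lc-sum c′ v j)) ⟩
    lc c v j + lc c′ v j                                 ∎

  lc-*ˡ : ∀ {k t} a (c : Fin k → Carrier) (v : Fin k → Vec t) → lc (λ i → a * c i) v ≈v a ·v lc c v
  lc-*ˡ {zero}  a c v j = sym (zeroʳ a)
  lc-*ˡ {suc k} a c v j =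
    trans (+-cong (*-assoc _ _ _) (lc-*ˡ a (c ∘ suc) (v ∘ suc) j)) (sym (distribˡ a _ _))

  lc-+ʳ : ∀ {k t} (c : Fin k → Carrier) (v w : Fin k → Vec t) → lc c (λ i → v i +v w i) ≈v lc c v +v lc c w
  lc-+ʳ {k} c v w j = begin
    lc c (λ i → v i +v w i) j                           ≈⟨ lc-sum c _ j ⟩
    sum (λ i → c i * (v i j + w i j))                   ≈⟨ sum-cong {k} (λ i → distribˡ _ _ _) ⟩
    sum (λ i → c i * v i j + c i * w i j)               ≈⟨ ∑-distrib-+ {k} (λ i → c i * v i j) (λ i → c i * w i j) ⟩
    sum (λ i → c i * v i j) + sum (λ i → c i * w i j)   ≈⟨ sym (+-cong (lc-sum c v j) (lc-sum c w j)) ⟩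
    lc c v j + lc c w j                                 ∎

  lc-negˡ : ∀ {k t} (c : Fin k → Carrier) (v : Fin k → Vec t) → lc (λ i → - c i) v ≈v -v lc c v
  lc-negˡ c v j = begin
    lc (λ i → - c i) v j         ≈⟨ lc-congˡ (λ i → sym (-1*x≈-x (c i))) j ⟩
    lc (λ i → - 1# * c i) v j    ≈⟨ lc-*ˡ (- 1#) c v j ⟩
    - 1# * lc c v j              ≈⟨ -1*x≈-x _ ⟩
    - lc c v j                   ∎

  lc-lc : ∀ {k l t} (c : Fin k → Carrier) (M : Fin k → Fin l → Carrier) (w : Fin l → Vec t) →
    lc c (λ i → lc (M i) w) ≈v lc (λ r → sum (λ i → c i * M i r)) w
  lc-lc {k} {l} c M w j = begin
    lc c (λ i → lc (M i) w) j                         ≈⟨ lc-sum c _ j ⟩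
    sum (λ i → c i * lc (M i) w j)                    ≈⟨ sum-cong {k} (λ i → *-congˡ (lc-sum (M i) w j)) ⟩
    sum (λ i → c i * sum (λ r → M i r * w r j))       ≈⟨ sum-cong {k} (λ i → *-distribˡ-sum (c i) (λ r → M i r * w r j)) ⟩
    sum (λ i → sum (λ r → c i * (M i r * w r j)))     ≈⟨ ∑-comm {k} {l} (λ i r → c i * (M i r * w r j)) ⟩
    sum (λ r → sum (λ i → c i * (M i r * w r j)))     ≈⟨ sum-cong {l} (λ r → sum-cong {k} (λ i → sym (*-assoc _ _ _))) ⟩
    sum (λ r → sum (λ i → c i * M i r * w r j))       ≈⟨ sum-cong {l} (λ r → sym (*-distribʳ-sum (w r j) (λ i → c i * M i r))) ⟩
    sum (λ r → sum (λ i → c i * M i r) * w r j)       ≈⟨ sym (lc-sum _ w j) ⟩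
    lc (λ r → sum (λ i → c i * M i r)) w j            ∎

  lc-unit : ∀ {k t} (i : Fin k) (v : Fin k → Vec t) → lc (unit i) v ≈v v i
  lc-unit i v j = trans (lc-sum _ v j) (sum-unitˡ i (λ r → v r j))

  lc-const : ∀ {k t} (c μ : Fin k → Carrier) (y : Vec t) → lc c (λ i → μ i ·v y) ≈v sum (λ i → c i * μ i) ·v y
  lc-const {k} c μ y r = begin
    lc c (λ i → μ i ·v y) r          ≈⟨ lc-sum c _ r ⟩
    sum (λ i → c i * (μ i * y r))    ≈⟨ sum-cong {k} (λ i → sym (*-assoc _ _ _)) ⟩
    sum (λ i → c i * μ i * y r)      ≈⟨ sym (*-distribʳ-sum (y r) (λ i → c i * μ i)) ⟩
    sum (λ i → c i * μ i) * y r      ∎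

  lc-take-drop : ∀ a {b t} (c : Fin (a ℕ.+ b) → Carrier) (v : Fin (a ℕ.+ b) → Vec t) →
    lc c v ≈v lc (take a c) (take a v) +v lc (drop a c) (drop a v)
  lc-take-drop zero    c v j = sym (+-identityˡ _)
  lc-take-drop (suc a) c v j = trans (+-congˡ (lc-take-drop a (c ∘ suc) (v ∘ suc) j)) (sym (+-assoc _ _ _))

  lc-++ : ∀ {p r t} (c : Fin (p ℕ.+ r) → Carrier) (v : Fin p → Vec t) (v′ : Fin r → Vec t) →
    lc c (v ++ v′) ≈v lc (take p c) v +v lc (drop p c) v′
  lc-++ {p} c v v′ j = trans (lc-take-drop p c (v ++ v′) j)
    (+-cong (lc-congʳ (λ i → ≡⇒≈v (lookup-++ˡ v v′ i)) j) (lc-congʳ (λ i → ≡⇒≈v (lookup-++ʳ v v′ i)) j))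

  lc-++-++ : ∀ {p r t} (c : Fin p → Carrier) (c′ : Fin r → Carrier) (v : Fin p → Vec t) (v′ : Fin r → Vec t) →
    lc (c ++ c′) (v ++ v′) ≈v lc c v +v lc c′ v′
  lc-++-++ c c′ v v′ j = trans (lc-++ (c ++ c′) v v′ j)
    (+-cong (lc-congˡ (λ i → ≡⇒≈ (lookup-++ˡ c c′ i)) j) (lc-congˡ (λ i → ≡⇒≈ (lookup-++ʳ c c′ i)) j))

  lc-remove : ∀ {k t} (i : Fin (suc k)) (c : Fin (suc k) → Carrier) (v : Fin (suc k) → Vec t) →
    lc c v ≈v c i ·v v i +v lc (removeAt c i) (removeAt v i)
  lc-remove i c v j = begin
    lc c v j                                                    ≈⟨ lc-sum c v j ⟩
    sum (λ r → c r * v r j)                                     ≈⟨ sum-remove {i = i} (λ r → c r * v r j) ⟩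
    c i * v i j + sum (λ r → c (punchIn i r) * v (punchIn i r) j) ≈⟨ +-congˡ (sym (lc-sum (removeAt c i) (removeAt v i) j)) ⟩
    c i * v i j + lc (removeAt c i) (removeAt v i) j            ∎

  record IsLinear {a b} (f : Vec a → Vec b) : Set where
    field
      cong   : ∀ {x y} → x ≈v y → f x ≈v f y
      +-homo : ∀ x y → f (x +v y) ≈v f x +v f y
      ·-homo : ∀ c x → f (c ·v x) ≈v c ·v f x

  module _ {a b} {f : Vec a → Vec b} (f-linear : IsLinear f) where
    open IsLinear f-linear

    linear-0 : f 0v ≈v 0v
    linear-0 j = trans (cong (λ i → sym (zeroˡ 0#)) j) (trans (·-homo 0# 0v j) (zeroˡ _))

    linear-lc : ∀ {k} (c : Fin k → Carrier) (v : Fin k → Vec a) → f (lc c v) ≈v lc c (f ∘ v)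
    linear-lc {zero}  c v = linear-0
    linear-lc {suc k} c v j = trans (+-homo _ _ j) (+-cong (·-homo (c zero) (v zero) j) (linear-lc (c ∘ suc) (v ∘ suc) j))

    linear-neg : ∀ x → f (-v x) ≈v -v f x
    linear-neg x j = trans (cong (-v≈-1·v x) j) (trans (·-homo (- 1#) x j) (sym (-v≈-1·v (f x) j)))

  module _ {a b : ℕ} where

    take-++ : (x : Vec a) (y : Vec b) → take a (x ++ y) ≈v x
    take-++ x y i = ≡⇒≈ (lookup-++ˡ x y i)

    drop-++ : (x : Vec a) (y : Vec b) → drop a (x ++ y) ≈v y
    drop-++ x y i = ≡⇒≈ (lookup-++ʳ x y i)

    take-++-drop : (z : Vec (a ℕ.+ b)) → z ≈v take a z ++ drop a z
    take-++-drop z = ↑-elim (λ i → z i ≈ (take a z ++ drop a z) i)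
      (λ j → sym (take-++ (take a z) (drop a z) j)) (λ j → sym (drop-++ (take a z) (drop a z) j))

    ++-cong : ∀ {x x′ : Vec a} {y y′ : Vec b} → x ≈v x′ → y ≈v y′ → x ++ y ≈v x′ ++ y′
    ++-cong x≈ y≈ i with splitAt a i
    ... | inj₁ j = x≈ j
    ... | inj₂ j = y≈ j

    ++-zero : (z : Vec (a ℕ.+ b)) → take a z ≈v 0v → drop a z ≈v 0v → z ≈v 0v
    ++-zero z = ↑-elim (λ i → z i ≈ 0#)

    +v-++ : (x x′ : Vec a) (y y′ : Vec b) → (x ++ y) +v (x′ ++ y′) ≈v (x +v x′) ++ (y +v y′)
    +v-++ x x′ y y′ i with splitAt a i
    ... | inj₁ j = refl
    ... | inj₂ j = refl

    ·v-++ : ∀ c (x : Vec a) (y : Vec b) → c ·v (x ++ y) ≈v (c ·v x) ++ (c ·v y)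
    ·v-++ c x y i with splitAt a i
    ... | inj₁ j = refl
    ... | inj₂ j = refl

    take-linear : IsLinear (take a {b})
    take-linear = record { cong = λ e i → e _ ; +-homo = λ x y i → refl ; ·-homo = λ c x i → refl }

    drop-linear : IsLinear (drop a {b})
    drop-linear = record { cong = λ e i → e _ ; +-homo = λ x y i → refl ; ·-homo = λ c x i → refl }

    padʳ-linear : IsLinear (λ (x : Vec a) → x ++ 0v {b})
    padʳ-linear = record
      { cong   = λ e → ++-cong e ≈v-refl
      ; +-homo = λ x y → ≈v-trans (++-cong ≈v-refl (λ _ → sym (+-identityʳ 0#))) (≈v-sym (+v-++ x y 0v 0v))
      ; ·-homo = λ c x → ≈v-trans (++-cong ≈v-refl (λ _ → sym (zeroʳ c))) (≈v-sym (·v-++ c x 0v)) }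

    padˡ-linear : IsLinear (λ (y : Vec b) → 0v {a} ++ y)
    padˡ-linear = record
      { cong   = ++-cong ≈v-refl
      ; +-homo = λ x y → ≈v-trans (++-cong (λ _ → sym (+-identityʳ 0#)) ≈v-refl) (≈v-sym (+v-++ 0v 0v x y))
      ; ·-homo = λ c x → ≈v-trans (++-cong (λ _ → sym (zeroʳ c)) ≈v-refl) (≈v-sym (·v-++ c 0v x)) }

  infixr 5 _⊕_

  _⊕_ : ∀ {k₁ k₂ t₁ t₂} → (Fin k₁ → Vec t₁) → (Fin k₂ → Vec t₂) → Fin (k₁ ℕ.+ k₂) → Vec (t₁ ℕ.+ t₂)
  G₁ ⊕ G₂ = (λ r → G₁ r ++ 0v) ++ (λ r → 0v ++ G₂ r)

  ⨁ : ∀ {m k t} → (Fin m → Fin k → Vec t) → Fin (m ℕ.* k) → Vec (m ℕ.* t)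
  ⨁ {zero}  Gs = λ ()
  ⨁ {suc m} Gs = Gs zero ⊕ ⨁ (Gs ∘ suc)

  module _ {k₁ k₂ t₁ t₂} (G₁ : Fin k₁ → Vec t₁) (G₂ : Fin k₂ → Vec t₂) where

    lc-⊕ : ∀ c → lc c (G₁ ⊕ G₂) ≈v lc (take k₁ c) G₁ ++ lc (drop k₁ c) G₂
    lc-⊕ c = ≈v-trans (lc-++ c (λ r → G₁ r ++ 0v) (λ r → 0v ++ G₂ r))
      (≈v-trans (λ i → sym (+-cong (linear-lc (padʳ-linear {t₁} {t₂}) (take k₁ c) G₁ i) (linear-lc (padˡ-linear {t₁} {t₂}) (drop k₁ c) G₂ i)))
        (≈v-trans (+v-++ {t₁} {t₂} _ 0v 0v _) (++-cong {t₁} {t₂} (λ _ → +-identityʳ _) (λ _ → +-identityˡ _))))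

    transpose-⊕ : ∀ j i → transpose (G₁ ⊕ G₂) j i ≡ (transpose G₁ ⊕ transpose G₂) j i
    transpose-⊕ j i = ≡.trans (by-row (splitAt k₁ i)) (≡.sym (by-column (splitAt t₁ j)))
      where
      entry : Fin k₁ ⊎ Fin k₂ → Fin t₁ ⊎ Fin t₂ → Carrier
      entry x y = [ (λ r → [ G₁ r , (λ _ → 0#) ]′ y) , (λ r → [ (λ _ → 0#) , G₂ r ]′ y) ]′ x
      by-row : ∀ x → [ (λ r → G₁ r ++ 0v) , (λ r → 0v ++ G₂ r) ]′ x j ≡ entry x (splitAt t₁ j)
      by-row (inj₁ r) = ≡.refl
      by-row (inj₂ r) = ≡.refl
      by-column : ∀ y → [ (λ s → transpose G₁ s ++ 0v) , (λ s → 0v ++ transpose G₂ s) ]′ y i ≡ entry (splitAt k₁ i) y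
      by-column (inj₁ s) = ≡.refl
      by-column (inj₂ s) = ≡.refl


module LinearAlgebra (L : Field) (_≟_ : ∀ x y → Dec (Field._≈_ L x y))
                     (S : Scalars L) (S-subfield : IsSubfield L S)
                     (S-searchable : Searchable (Field.Carrier L) (Field._≈_ L) S) where
  open Vectors L
  module S = IsSubfield S-subfield

  Span : ∀ {k t} → (Fin k → Vec t) → Vec t → Set
  Span = InSpan L S

  Indep : ∀ {k t} → (Fin k → Vec t) → Set
  Indep = Independent L S

  Dim : ∀ {t} → (Vec t → Set) → ℕ → Set
  Dim = HasDim L S

  Subspace : ∀ {t} → (Vec t → Set) → Set
  Subspace = IsSubspace L S

  IsBasis : ∀ {k t} → (Vec t → Set) → (Fin k → Vec t) → Set
  IsBasis W b = (∀ i → W (b i)) × Indep b × (∀ x → W x → Span b x)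

  search-coefficients : ∀ d → Searchable (Fin d → Carrier) (λ f g → ∀ i → f i ≈ g i) (λ f → ∀ i → S (f i))
  search-coefficients = searchable-Vector refl S-searchable

  _≈v?_ : ∀ {t} (x y : Vec t) → Dec (x ≈v y)
  x ≈v? y = all? (λ j → x j ≟ y j)

  S-unit : ∀ {k} (i j : Fin k) → S (unit i j)
  S-unit zero    zero    = S.1∈
  S-unit zero    (suc j) = S.0∈
  S-unit (suc i) zero    = S.0∈
  S-unit (suc i) (suc j) = S-unit i j

  S-sum : ∀ {k} {f : Fin k → Carrier} → (∀ i → S (f i)) → S (sum f)
  S-sum {zero}  Sf = S.0∈
  S-sum {suc k} Sf = S.+∈ (Sf zero) (S-sum (Sf ∘ suc))

  S-insertAt : ∀ {d} {γ : Fin d → Carrier} {ν} i → (∀ j → S (γ j)) → S ν → ∀ k → S (insertAt γ i ν k)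
  S-insertAt {γ = γ} {ν} i Sγ Sν k with i Fin.≟ k
  ... | yes ≡.refl = ≡.subst S (≡.sym (insertAt-lookup γ i ν)) Sν
  ... | no i≢k = ≡.subst (S ∘ insertAt γ i ν) (punchIn-punchOut i≢k)
                   (≡.subst S (≡.sym (insertAt-punchIn γ i ν (punchOut i≢k))) (Sγ _))

  span-resp : ∀ {k t} {v : Fin k → Vec t} {x y} → x ≈v y → Span v x → Span v y
  span-resp x≈y (c , Sc , x≈) = c , Sc , ≈v-trans (≈v-sym x≈y) x≈

  span-resp-family : ∀ {k t} {v v′ : Fin k → Vec t} {x} → (∀ i → v i ≈v v′ i) → Span v x → Span v′ x
  span-resp-family v≈ (c , Sc , x≈) = c , Sc , ≈v-trans x≈ (lc-congʳ v≈)

  span-0 : ∀ {k t} (v : Fin k → Vec t) → Span v 0v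
  span-0 v = (λ _ → 0#) , (λ _ → S.0∈) , ≈v-sym (lc-zeroˡ v (λ _ → refl))

  span-lc : ∀ {k t} (v : Fin k → Vec t) c → (∀ i → S (c i)) → Span v (lc c v)
  span-lc v c Sc = c , Sc , ≈v-refl

  span-member : ∀ {k t} (v : Fin k → Vec t) i → Span v (v i)
  span-member v i = unit i , S-unit i , ≈v-sym (lc-unit i v)

  span-subspace : ∀ {k t} (v : Fin k → Vec t) → Subspace (Span v)
  span-subspace v = record
    { resp  = span-resp
    ; zero∈ = span-0 v
    ; +∈    = λ (c , Sc , x≈) (c′ , Sc′ , y≈) → (λ i → c i + c′ i) , (λ i → S.+∈ (Sc i) (Sc′ i)) ,
                λ j → trans (+-cong (x≈ j) (y≈ j)) (sym (lc-+ˡ c c′ v j))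
    ; ·∈    = λ {a} Sa (c , Sc , x≈) → (λ i → a * c i) , (λ i → S.*∈ Sa (Sc i)) ,
                λ j → trans (*-congˡ (x≈ j)) (sym (lc-*ˡ a c v j)) }

  span-trans : ∀ {k l t} {v : Fin k → Vec t} {w : Fin l → Vec t} {x} → (∀ i → Span w (v i)) → Span v x → Span w x
  span-trans {v = v} {w} v⊆w (c , Sc , x≈) =
    (λ r → sum (λ i → c i * M i r)) , (λ r → S-sum (λ i → S.*∈ (Sc i) (proj₁ (proj₂ (v⊆w i)) r))) ,
    ≈v-trans x≈ (≈v-trans (lc-congʳ (λ i → proj₂ (proj₂ (v⊆w i)))) (lc-lc c M w))
    where
    M : _ → _ → Carrier
    M i = proj₁ (v⊆w i)

  span? : ∀ {k t} (v : Fin k → Vec t) x → Dec (Span v x)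
  span? {k} v x = search-coefficients k (λ c → x ≈v lc c v) (λ c≈ x≈ → ≈v-trans x≈ (lc-congˡ c≈)) (λ c → x ≈v? lc c v)

  subspace-lc : ∀ {k t} {W : Vec t → Set} → Subspace W → (v : Fin k → Vec t) → (∀ i → W (v i)) → ∀ c → (∀ i → S (c i)) → W (lc c v)
  subspace-lc {zero}  W-sub v Wv c Sc = IsSubspace.zero∈ W-sub
  subspace-lc {suc k} W-sub v Wv c Sc =
    IsSubspace.+∈ W-sub (IsSubspace.·∈ W-sub (Sc zero) (Wv zero)) (subspace-lc W-sub (v ∘ suc) (Wv ∘ suc) (c ∘ suc) (Sc ∘ suc))

  subspace-span : ∀ {k t} {W : Vec t → Set} → Subspace W → (v : Fin k → Vec t) → (∀ i → W (v i)) → ∀ {x} → Span v x → W x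
  subspace-span W-sub v Wv (c , Sc , x≈) = IsSubspace.resp W-sub (≈v-sym x≈) (subspace-lc W-sub v Wv c Sc)

  subspace-neg : ∀ {t} {W : Vec t → Set} → Subspace W → ∀ {x} → W x → W (-v x)
  subspace-neg W-sub {x} Wx = IsSubspace.resp W-sub (≈v-sym (-v≈-1·v x)) (IsSubspace.·∈ W-sub (S.-∈ S.1∈) Wx)

  subspace-∩ : ∀ {t} {A B : Vec t → Set} → Subspace A → Subspace B → Subspace (A ∩ B)
  subspace-∩ A-sub B-sub = record
    { resp  = λ e (a , b) → IsSubspace.resp A-sub e a , IsSubspace.resp B-sub e b
    ; zero∈ = IsSubspace.zero∈ A-sub , IsSubspace.zero∈ B-sub
    ; +∈    = λ (a , b) (a′ , b′) → IsSubspace.+∈ A-sub a a′ , IsSubspace.+∈ B-sub b b′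
    ; ·∈    = λ s (a , b) → IsSubspace.·∈ A-sub s a , IsSubspace.·∈ B-sub s b }

  indep-resp : ∀ {k t} {v v′ : Fin k → Vec t} → (∀ i → v i ≈v v′ i) → Indep v → Indep v′
  indep-resp v≈ v-indep c Sc lc≈0 = v-indep c Sc (≈v-trans (lc-congʳ v≈) lc≈0)

  indep-[] : ∀ {t} (b : Fin 0 → Vec t) → Indep b
  indep-[] b c Sc lc≈0 ()

  Dependent : ∀ {k t} → (Fin k → Vec t) → Set
  Dependent v = ∃ λ c → (∀ i → S (c i)) × lc c v ≈v 0v × ∃ λ i → ¬ c i ≈ 0#

  indep⊎dep : ∀ {k t} (v : Fin k → Vec t) → Indep v ⊎ Dependent v
  indep⊎dep {k} v with search-coefficients k (λ c → lc c v ≈v 0v × ∃ λ i → ¬ c i ≈ 0#)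
    (λ c≈ (lc≈0 , i , ci≉0) → ≈v-trans (lc-congˡ (λ i → sym (c≈ i))) lc≈0 , i , λ c′i≈0 → ci≉0 (trans (c≈ i) c′i≈0))
    (λ c → (lc c v ≈v? 0v) ×-dec any? (λ i → ¬? (c i ≟ 0#)))
  ... | yes dep  = inj₂ dep
  ... | no ¬dep = inj₁ (λ c Sc lc≈0 i → decidable-stable (c i ≟ 0#) (λ ci≉0 → ¬dep (c , Sc , lc≈0 , i , ci≉0)))

  indep? : ∀ {k t} (v : Fin k → Vec t) → Dec (Indep v)
  indep? v with indep⊎dep v
  ... | inj₁ indep = yes indep
  ... | inj₂ (c , Sc , lc≈0 , i , ci≉0) = no (λ indep → ci≉0 (indep c Sc lc≈0 i))

  span-removeAt : ∀ {d t} {v : Fin (suc d) → Vec t} c → (∀ i → S (c i)) → lc c v ≈v 0v →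
    ∀ i → ¬ c i ≈ 0# → Span (removeAt v i) (v i)
  span-removeAt {v = v} c Sc lc≈0 i ci≉0 =
    span-resp (λ l → sym (isolate (trans (sym (lc-remove i c v l)) (lc≈0 l)) ci*y≈1))
      (IsSubspace.·∈ (span-subspace _) (S.-∈ (S.inv∈ (Sc i) ci*y≈1)) (span-lc (removeAt v i) (removeAt c i) (Sc ∘ punchIn i)))
    where
    ci*y≈1 : c i * proj₁ (inverse (c i) ci≉0) ≈ 1#
    ci*y≈1 = proj₂ (inverse (c i) ci≉0)

  indep-∷ : ∀ {d t} {b : Fin d → Vec t} {x} → Indep b → ¬ Span b x → Indep (x ∷ b)
  indep-∷ {b = b} {x} b-indep x∉b c Sc lc≈0 = c≈0
    where
    c₀≈0 : c zero ≈ 0#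
    c₀≈0 = decidable-stable (c zero ≟ 0#) (x∉b ∘ span-removeAt {v = x ∷ b} c Sc lc≈0 zero)
    tail≈0 : lc (c ∘ suc) b ≈v 0v
    tail≈0 j = trans (sym (+-identityˡ _)) (trans (+-congʳ (sym (trans (*-congʳ c₀≈0) (zeroˡ _)))) (lc≈0 j))
    c≈0 : ∀ i → c i ≈ 0#
    c≈0 zero    = c₀≈0
    c≈0 (suc i) = b-indep (c ∘ suc) (Sc ∘ suc) tail≈0 i

  span-tail : ∀ {e t} {w : Fin (suc e) → Vec t} {x} c → (∀ i → S (c i)) → x ≈v lc c w → c zero ≈ 0# → Span (w ∘ suc) x
  span-tail c Sc x≈ c₀≈0 = c ∘ suc , Sc ∘ suc , λ j → trans (x≈ j) (trans (+-congʳ (trans (*-congʳ c₀≈0) (zeroˡ _))) (+-identityˡ _))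

  steinitz : ∀ e {d t} (b : Fin d → Vec t) (w : Fin e → Vec t) → Indep b → (∀ i → Span w (b i)) → d ≤ e

  -- Use b i₀, whose w₀-coordinate is invertible, to eliminate w₀ from the other b i.
  steinitz-exchange : ∀ e {d t} (b : Fin (suc d) → Vec t) (w : Fin (suc e) → Vec t) → Indep b →
    (b⊆w : ∀ i → Span w (b i)) → ∀ i₀ → ¬ proj₁ (b⊆w i₀) zero ≈ 0# → d ≤ e
  steinitz-exchange e {d} b w b-indep b⊆w i₀ C₀≉0 = steinitz e b′ (w ∘ suc) b′-indep b′⊆w′
    where
    C : Fin (suc d) → Fin (suc e) → Carrier
    C i = proj₁ (b⊆w i)
    SC : ∀ i r → S (C i r)
    SC i = proj₁ (proj₂ (b⊆w i))
    y : Carrier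
    y = proj₁ (inverse (C i₀ zero) C₀≉0)
    C₀*y≈1 : C i₀ zero * y ≈ 1#
    C₀*y≈1 = proj₂ (inverse (C i₀ zero) C₀≉0)
    μ : Fin d → Carrier
    μ j = - (C (punchIn i₀ j) zero * y)
    Sμ : ∀ j → S (μ j)
    Sμ j = S.-∈ (S.*∈ (SC (punchIn i₀ j) zero) (S.inv∈ (SC i₀ zero) C₀*y≈1))
    b′ : Fin d → Vec _
    b′ j = b (punchIn i₀ j) +v μ j ·v b i₀
    D : Fin d → Fin (suc e) → Carrier
    D j r = C (punchIn i₀ j) r + μ j * C i₀ r
    D₀≈0 : ∀ j → D j zero ≈ 0#
    D₀≈0 j = begin
      C (punchIn i₀ j) zero + - (C (punchIn i₀ j) zero * y) * C i₀ zero
        ≈⟨ +-congˡ (sym (-‿distribˡ-* _ _)) ⟩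
      C (punchIn i₀ j) zero - C (punchIn i₀ j) zero * y * C i₀ zero
        ≈⟨ +-congˡ (-‿cong (trans (*-assoc _ _ _) (trans (*-congˡ (trans (*-comm _ _) C₀*y≈1)) (*-identityʳ _)))) ⟩
      C (punchIn i₀ j) zero - C (punchIn i₀ j) zero
        ≈⟨ -‿inverseʳ _ ⟩
      0# ∎
    b′⊆w′ : ∀ j → Span (w ∘ suc) (b′ j)
    b′⊆w′ j = span-tail {w = w} (D j) (λ r → S.+∈ (SC _ r) (S.*∈ (Sμ j) (SC i₀ r)))
      (λ l → trans (+-cong (proj₂ (proj₂ (b⊆w (punchIn i₀ j))) l) (*-congˡ (proj₂ (proj₂ (b⊆w i₀)) l)))
                   (sym (trans (lc-+ˡ (C (punchIn i₀ j)) (λ r → μ j * C i₀ r) w l) (+-congˡ (lc-*ˡ (μ j) (C i₀) w l)))))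
      (D₀≈0 j)
    b′-indep : Indep b′
    b′-indep γ Sγ lc≈0 j = trans (sym (≡⇒≈ (insertAt-punchIn γ i₀ ν j))) (b-indep Γ SΓ lcΓ≈0 (punchIn i₀ j))
      where
      ν = sum (λ j → γ j * μ j)
      Γ = insertAt γ i₀ ν
      SΓ : ∀ k → S (Γ k)
      SΓ = S-insertAt i₀ Sγ (S-sum (λ j → S.*∈ (Sγ j) (Sμ j)))
      lcΓ≈0 : lc Γ b ≈v 0v
      lcΓ≈0 l = begin
        lc Γ b l
          ≈⟨ lc-remove i₀ Γ b l ⟩
        Γ i₀ * b i₀ l + lc (removeAt Γ i₀) (removeAt b i₀) l
          ≈⟨ +-cong (*-congʳ (≡⇒≈ (insertAt-lookup γ i₀ ν))) (lc-congˡ (λ j → ≡⇒≈ (insertAt-punchIn γ i₀ ν j)) l) ⟩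
        ν * b i₀ l + lc γ (removeAt b i₀) l
          ≈⟨ +-comm _ _ ⟩
        lc γ (removeAt b i₀) l + ν * b i₀ l
          ≈⟨ +-congˡ (sym (lc-const γ μ (b i₀) l)) ⟩
        lc γ (removeAt b i₀) l + lc γ (λ j → μ j ·v b i₀) l
          ≈⟨ sym (lc-+ʳ γ _ _ l) ⟩
        lc γ b′ l
          ≈⟨ lc≈0 l ⟩
        0# ∎

  steinitz zero {zero} b w b-indep b⊆w = z≤n
  steinitz zero {suc d} b w b-indep b⊆w =
    ⊥-elim (0≉1 (sym (b-indep (unit zero) (S-unit zero) (≈v-trans (lc-unit zero b) (proj₂ (proj₂ (b⊆w zero)))) zero)))
  steinitz (suc e) {zero} b w b-indep b⊆w = z≤n
  steinitz (suc e) {suc d} b w b-indep b⊆w with any? (λ i → ¬? (proj₁ (b⊆w i) zero ≟ 0#))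
  ... | yes (i₀ , C₀≉0) = s≤s (steinitz-exchange e b w b-indep b⊆w i₀ C₀≉0)
  ... | no none = ℕ.m≤n⇒m≤1+n (steinitz e b (w ∘ suc) b-indep λ i →
          let (c , Sc , b≈) = b⊆w i in
          span-tail {w = w} c Sc b≈ (decidable-stable (c zero ≟ 0#) (λ c₀≉0 → none (i , c₀≉0))))

  indep≤dim : ∀ {t d d′} {W : Vec t → Set} (b : Fin d → Vec t) → Indep b → (∀ i → W (b i)) → Dim W d′ → d ≤ d′
  indep≤dim b b-indep Wb (B , _ , _ , B-spans) = steinitz _ b B b-indep (λ i → B-spans (b i) (Wb i))

  dim-unique : ∀ {t d d′} {W : Vec t → Set} → Dim W d → Dim W d′ → d ≡ d′
  dim-unique D@(b , Wb , b-indep , _) D′@(b′ , Wb′ , b′-indep , _) =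
    ℕ.≤-antisym (indep≤dim b b-indep Wb D′) (indep≤dim b′ b′-indep Wb′ D)

  dim-resp : ∀ {t d} {W W′ : Vec t → Set} → (∀ x → W x → W′ x) → (∀ x → W′ x → W x) → Dim W d → Dim W′ d
  dim-resp W⊆W′ W′⊆W (b , Wb , b-indep , b-spans) = b , (λ i → W⊆W′ _ (Wb i)) , b-indep , (λ x → b-spans x ∘ W′⊆W x)

  dim-mono : ∀ {t d d′} {W W′ : Vec t → Set} → (∀ x → W x → W′ x) → Dim W d → Dim W′ d′ → d ≤ d′
  dim-mono W⊆W′ (b , Wb , b-indep , _) = indep≤dim b b-indep (λ i → W⊆W′ _ (Wb i))

  dim-span : ∀ {k t} (v : Fin k → Vec t) → Indep v → Dim (Span v) k
  dim-span v v-indep = v , span-member v , v-indep , λ x x∈v → x∈v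

  -- Greedily extend an independent family inside W; by steinitz it has at most N members.
  dim-exists : ∀ {t N} (W : Vec t → Set) → Subspace W → (∀ x → Dec (W x)) →
    (w : Fin N → Vec t) → (∀ x → W x → Span w x) → ∃ (Dim W)
  dim-exists {t} {N} W W-sub W? w W⊆w = extend N (λ ()) (indep-[] (λ ())) (λ ()) ≡.refl
    where
    extend : ∀ f {d} (b : Fin d → Vec t) → Indep b → (∀ i → W (b i)) → d ℕ.+ f ≡ N → ∃ (Dim W)
    extend f {d} b b-indep Wb d+f≡N with search-coefficients N (λ c → W (lc c w) × ¬ Span b (lc c w))
      (λ c≈ (W∋ , ∉b) → IsSubspace.resp W-sub (lc-congˡ c≈) W∋ , ∉b ∘ span-resp (lc-congˡ (λ i → sym (c≈ i))))
      (λ c → W? (lc c w) ×-dec ¬? (span? b (lc c w)))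
    ... | no none = d , b , Wb , b-indep , λ x Wx → decidable-stable (span? b x) λ x∉b →
            let (c , Sc , x≈) = W⊆w x Wx in
            none (c , Sc , IsSubspace.resp W-sub x≈ Wx , x∉b ∘ span-resp (≈v-sym x≈))
    ... | yes (c , Sc , W∋ , ∉b) with f
    ...   | suc f = extend f (lc c w ∷ b) (indep-∷ b-indep ∉b) (All-∷ {P = W} W∋ Wb) (≡.trans (≡.sym (ℕ.+-suc d f)) d+f≡N)
    ...   | zero  = ⊥-elim (ℕ.<-irrefl ≡.refl (≡.subst (suc d ≤_) (≡.trans (≡.sym d+f≡N) (ℕ.+-identityʳ d))
                      (steinitz N (lc c w ∷ b) w (indep-∷ b-indep ∉b) (All-∷ {P = Span w} (span-lc w c Sc) (λ i → W⊆w (b i) (Wb i))))))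

  subspace? : ∀ {t w} {W : Vec t → Set} → Subspace W → (b : Fin w → Vec t) → IsBasis W b → ∀ x → Dec (W x)
  subspace? W-sub b (Wb , _ , b-spans) x = map′ (subspace-span W-sub b Wb) (b-spans x) (span? b x)

  module _ {t t′} {W : Vec t → Set} (W-sub : Subspace W) {f : Vec t → Vec t′} (f-linear : IsLinear f) where
    open IsLinear f-linear using () renaming (cong to f-cong; +-homo to f-+)

    Kernel : Vec t → Set
    Kernel x = W x × f x ≈v 0v

    kernel-subspace : Subspace Kernel
    kernel-subspace = record
      { resp  = λ x≈y (Wx , fx≈0) → IsSubspace.resp W-sub x≈y Wx , ≈v-trans (f-cong (≈v-sym x≈y)) fx≈0
      ; zero∈ = IsSubspace.zero∈ W-sub , linear-0 f-linear
      ; +∈    = λ (Wx , fx≈0) (Wy , fy≈0) → IsSubspace.+∈ W-sub Wx Wy ,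
                  λ j → trans (f-+ _ _ j) (trans (+-cong (fx≈0 j) (fy≈0 j)) (+-identityʳ 0#))
      ; ·∈    = λ Sa (Wx , fx≈0) → IsSubspace.·∈ W-sub Sa Wx ,
                  λ j → trans (IsLinear.·-homo f-linear _ _ j) (trans (*-congˡ (fx≈0 j)) (zeroʳ _)) }

    basis-kernel-++-lift : ∀ {p r} {κ : Fin p → Vec t} {xs : Fin r → Vec t} → IsBasis Kernel κ →
      (∀ l → W (xs l)) → Indep (f ∘ xs) → (∀ x → W x → Span (f ∘ xs) (f x)) → IsBasis W (κ ++ xs)
    basis-kernel-++-lift {p} {r} {κ} {xs} (Kκ , κ-indep , κ-spans) Wxs fxs-indep f⊆fxs =
      ++⁺ W (proj₁ ∘ Kκ) Wxs , indep , spans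
      where
      indep : Indep (κ ++ xs)
      indep c Sc lc≈0 = ↑-elim (λ i → c i ≈ 0#) c₁≈0 c₂≈0
        where
        split≈0 : lc (take p c) κ +v lc (drop p c) xs ≈v 0v
        split≈0 = ≈v-trans (≈v-sym (lc-++ c κ xs)) lc≈0
        image≈0 : lc (drop p c) (f ∘ xs) ≈v 0v
        image≈0 j = begin
          lc (drop p c) (f ∘ xs) j                          ≈⟨ sym (+-identityˡ _) ⟩
          0# + lc (drop p c) (f ∘ xs) j                     ≈⟨ sym (+-congʳ (lc-zeroʳ (take p c) (proj₂ ∘ Kκ) j)) ⟩
          lc (take p c) (f ∘ κ) j + lc (drop p c) (f ∘ xs) j ≈⟨ sym (+-cong (linear-lc f-linear _ κ j) (linear-lc f-linear _ xs j)) ⟩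
          f (lc (take p c) κ) j + f (lc (drop p c) xs) j     ≈⟨ sym (f-+ _ _ j) ⟩
          f (lc (take p c) κ +v lc (drop p c) xs) j          ≈⟨ f-cong split≈0 j ⟩
          f 0v j                                            ≈⟨ linear-0 f-linear j ⟩
          0#                                                ∎
        c₂≈0 : ∀ a → drop p c a ≈ 0#
        c₂≈0 = fxs-indep (drop p c) (Sc ∘ (p Fin.↑ʳ_)) image≈0
        c₁≈0 : ∀ a → take p c a ≈ 0#
        c₁≈0 = κ-indep (take p c) (Sc ∘ (Fin._↑ˡ r)) λ j →
          trans (sym (+-identityʳ _)) (trans (+-congˡ (sym (lc-zeroˡ xs c₂≈0 j))) (split≈0 j))
      spans : ∀ y → W y → Span (κ ++ xs) y
      spans y Wy = h ++ g , ++⁺ S Sh Sg , ≈v-trans y≈ (≈v-sym (lc-++-++ h g κ xs))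
        where
        fy∈ = f⊆fxs y Wy
        g = proj₁ fy∈
        Sg = proj₁ (proj₂ fy∈)
        y′ = y +v -v lc g xs
        y′∈ker : Kernel y′
        y′∈ker = IsSubspace.+∈ W-sub Wy (subspace-neg W-sub (subspace-lc W-sub xs Wxs g Sg)) , λ j → begin
          f y′ j                          ≈⟨ f-+ _ _ j ⟩
          f y j + f (-v lc g xs) j        ≈⟨ +-congˡ (linear-neg f-linear _ j) ⟩
          f y j - f (lc g xs) j           ≈⟨ +-cong (proj₂ (proj₂ fy∈) j) (-‿cong (linear-lc f-linear g xs j)) ⟩
          lc g (f ∘ xs) j - lc g (f ∘ xs) j ≈⟨ -‿inverseʳ _ ⟩
          0#                              ∎
        y′∈κ = κ-spans y′ y′∈ker
        h = proj₁ y′∈κ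
        Sh = proj₁ (proj₂ y′∈κ)
        y≈ : y ≈v lc h κ +v lc g xs
        y≈ j = begin
          y j                               ≈⟨ sym (+-identityʳ _) ⟩
          y j + 0#                          ≈⟨ +-congˡ (sym (-‿inverseˡ _)) ⟩
          y j + (- lc g xs j + lc g xs j)   ≈⟨ sym (+-assoc _ _ _) ⟩
          y′ j + lc g xs j                  ≈⟨ +-congʳ (proj₂ (proj₂ y′∈κ) j) ⟩
          lc h κ j + lc g xs j              ∎

    rank-nullity : ∀ {w} (b : Fin w → Vec t) → IsBasis W b →
      ∃₂ λ p r → Dim Kernel p × Dim (Span (f ∘ b)) r × p ℕ.+ r ≡ w
    rank-nullity b b-basis@(Wb , _ , b-spans) with
      dim-exists Kernel kernel-subspace (λ x → subspace? W-sub b b-basis x ×-dec (f x ≈v? 0v)) b (λ x → b-spans x ∘ proj₁) |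
      dim-exists (Span (f ∘ b)) (span-subspace (f ∘ b)) (span? (f ∘ b)) (f ∘ b) (λ _ y∈ → y∈)
    ... | p , κ , κ-basis | r , γ , fbγ , γ-indep , γ-spans =
      p , r , (κ , κ-basis) , (γ , fbγ , γ-indep , γ-spans) ,
      dim-unique (κ ++ xs , basis-kernel-++-lift κ-basis Wxs (indep-resp (≈v-sym ∘ fxs≈γ) γ-indep) f⊆fxs) (b , b-basis)
      where
      xs : Fin r → Vec t
      xs l = lc (proj₁ (fbγ l)) b
      Wxs : ∀ l → W (xs l)
      Wxs l = subspace-lc W-sub b Wb _ (proj₁ (proj₂ (fbγ l)))
      fxs≈γ : ∀ l → f (xs l) ≈v γ l
      fxs≈γ l = ≈v-trans (linear-lc f-linear _ b) (≈v-sym (proj₂ (proj₂ (fbγ l))))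
      f⊆fxs : ∀ x → W x → Span (f ∘ xs) (f x)
      f⊆fxs x Wx = span-resp-family (λ l → ≈v-sym (fxs≈γ l)) (γ-spans (f x) fx∈)
        where
        x∈ = b-spans x Wx
        fx∈ : Span (f ∘ b) (f x)
        fx∈ = proj₁ x∈ , proj₁ (proj₂ x∈) , ≈v-trans (f-cong (proj₂ (proj₂ x∈))) (linear-lc f-linear _ b)

  module _ {k₁ k₂ t₁ t₂} {G₁ : Fin k₁ → Vec t₁} {G₂ : Fin k₂ → Vec t₂} where

    indep-⊕ : Indep G₁ → Indep G₂ → Indep (G₁ ⊕ G₂)
    indep-⊕ G₁-indep G₂-indep c Sc lc≈0 = ↑-elim (λ i → c i ≈ 0#)
      (G₁-indep (take k₁ c) (Sc ∘ (Fin._↑ˡ k₂)) (λ j → trans (sym (take-++ {t₁} {t₂} _ _ j)) (halves≈0 (j Fin.↑ˡ t₂))))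
      (G₂-indep (drop k₁ c) (Sc ∘ (k₁ Fin.↑ʳ_)) (λ j → trans (sym (drop-++ {t₁} {t₂} _ _ j)) (halves≈0 (t₁ Fin.↑ʳ j))))
      where
      halves≈0 : lc (take k₁ c) G₁ ++ lc (drop k₁ c) G₂ ≈v 0v
      halves≈0 = ≈v-trans (≈v-sym (lc-⊕ G₁ G₂ c)) lc≈0

    span-⊕⁻ : ∀ {z} → Span (G₁ ⊕ G₂) z → Span G₁ (take t₁ z) × Span G₂ (drop t₁ z)
    span-⊕⁻ {z} (c , Sc , z≈) =
      (take k₁ c , Sc ∘ (Fin._↑ˡ k₂) , λ j → trans (z≈′ (j Fin.↑ˡ t₂)) (take-++ {t₁} {t₂} _ _ j)) ,
      (drop k₁ c , Sc ∘ (k₁ Fin.↑ʳ_) , λ j → trans (z≈′ (t₁ Fin.↑ʳ j)) (drop-++ {t₁} {t₂} _ _ j))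
      where
      z≈′ : z ≈v lc (take k₁ c) G₁ ++ lc (drop k₁ c) G₂
      z≈′ = ≈v-trans z≈ (lc-⊕ G₁ G₂ c)

    span-⊕⁺ : ∀ {z} → Span G₁ (take t₁ z) → Span G₂ (drop t₁ z) → Span (G₁ ⊕ G₂) z
    span-⊕⁺ {z} (c₁ , Sc₁ , z₁≈) (c₂ , Sc₂ , z₂≈) = c₁ ++ c₂ , ++⁺ S Sc₁ Sc₂ ,
      ≈v-trans (take-++-drop {t₁} {t₂} z) (≈v-trans (++-cong {t₁} {t₂} z₁≈ z₂≈) (≈v-sym (≈v-trans (lc-⊕ G₁ G₂ (c₁ ++ c₂))
        (++-cong {t₁} {t₂} (lc-congˡ (λ i → ≡⇒≈ (lookup-++ˡ c₁ c₂ i))) (lc-congˡ (λ i → ≡⇒≈ (lookup-++ʳ c₁ c₂ i)))))))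

  dim-padˡ : ∀ {a b d} {A : Vec b → Set} → (∀ {x y} → x ≈v y → A x → A y) → Dim A d →
    Dim (λ z → take a z ≈v 0v × A (drop a z)) d
  dim-padˡ {a} {b} {d} {A} A-resp (β , Aβ , β-indep , β-spans) = (λ l → 0v ++ β l) , member , indep , spans
    where
    member : ∀ l → take a (0v ++ β l) ≈v 0v × A (drop a (0v ++ β l))
    member l = take-++ {a} {b} 0v (β l) , A-resp (≈v-sym (drop-++ {a} {b} 0v (β l))) (Aβ l)
    indep : Indep (λ l → 0v ++ β l)
    indep c Sc lc≈0 = β-indep c Sc (≈v-trans (≈v-sym (drop-++ {a} {b} 0v (lc c β)))
      (IsLinear.cong (drop-linear {a} {b}) (≈v-trans (linear-lc (padˡ-linear {a} {b}) c β) lc≈0)))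
    spans : ∀ z → take a z ≈v 0v × A (drop a z) → Span (λ l → 0v ++ β l) z
    spans z (z₁≈0 , Az₂) = let (c , Sc , z₂≈) = β-spans (drop a z) Az₂ in
      c , Sc , ≈v-trans (take-++-drop {a} {b} z) (≈v-trans (++-cong {a} {b} z₁≈0 z₂≈) (linear-lc (padˡ-linear {a} {b}) c β))

  indep-drop : ∀ {a b k} {v : Fin k → Vec (a ℕ.+ b)} → Indep v → (∀ l → take a (v l) ≈v 0v) → Indep (drop a ∘ v)
  indep-drop {a} {b} {v = v} v-indep take≈0 c Sc lc≈0 = v-indep c Sc (++-zero {a} {b} (lc c v)
    (≈v-trans (linear-lc (take-linear {a} {b}) c v) (lc-zeroʳ c take≈0))
    (≈v-trans (linear-lc (drop-linear {a} {b}) c v) lc≈0))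

module FiniteExtension (L : Field) (K : Scalars L) (q n : ℕ) (ext : IsExtension L K q n) where
  open Vectors L
  open IsExtension ext
  module K = IsSubfield subfield

  private
    enum : Fin q → Carrier
    enum = proj₁ cardK
    enum-injective : ∀ i j → enum i ≈ enum j → i ≡ j
    enum-injective = proj₁ (proj₂ (proj₂ cardK))
    enum-surjective : ∀ x → K x → ∃ λ i → enum i ≈ x
    enum-surjective = proj₂ (proj₂ (proj₂ cardK))
    β : Fin n → V L 1
    β = proj₁ degree
    coordinates : ∀ x → InSpan L K β (λ _ → x)
    coordinates x = proj₂ (proj₂ (proj₂ degree)) (λ _ → x) tt

  searchable-K : Searchable Carrier _≈_ K
  searchable-K Q Q-resp Q? with any? (λ i → Q? (enum i))
  ... | yes (i , Qi) = yes (enum i , proj₁ (proj₂ cardK) i , Qi)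
  ... | no ¬Q = no λ (x , Kx , Qx) →
          let (i , i≈x) = enum-surjective x Kx in ¬Q (i , Q-resp (sym i≈x) Qx)

  K-zero? : ∀ x → K x → Dec (x ≈ 0#)
  K-zero? x Kx with enum-surjective x Kx | enum-surjective 0# K.0∈
  ... | i , i≈x | i₀ , i₀≈0 with i Fin.≟ i₀
  ... | yes ≡.refl = yes (trans (sym i≈x) i₀≈0)
  ... | no i≢i₀    = no λ x≈0 → i≢i₀ (enum-injective i i₀ (trans i≈x (trans x≈0 (sym i₀≈0))))

  -- x ≈ y iff all K-coordinates of x - y vanish.
  _≟_ : ∀ x y → Dec (x ≈ y)
  x ≟ y with coordinates (x - y)
  ... | c , Kc , x-y≈ with all? (λ i → K-zero? (c i) (Kc i))
  ... | yes c≈0 = yes (x∙y⁻¹≈ε⇒x≈y x y (trans (x-y≈ zero) (lc-zeroˡ β c≈0 zero)))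
  ... | no ¬c≈0 = no λ x≈y → ¬c≈0 (proj₁ (proj₂ (proj₂ degree)) c Kc
                    λ j → trans (sym (x-y≈ j)) (trans (+-congʳ x≈y) (-‿inverseʳ y)))

  searchable-L : Searchable Carrier _≈_ (All L)
  searchable-L Q Q-resp Q? with searchable-Vector refl searchable-K n (λ c → Q (lc c β zero))
    (λ c≈ → Q-resp (lc-congˡ c≈ zero)) (λ c → Q? (lc c β zero))
  ... | yes (c , _ , Qc) = yes (lc c β zero , tt , Qc)
  ... | no ¬Q = no λ (x , _ , Qx) →
          let (c , Kc , x≈) = coordinates x in ¬Q (c , Kc , Q-resp (x≈ zero) Qx)

  all-subfield : IsSubfield L (All L)
  all-subfield = record
    { resp = λ _ _ → tt ; 0∈ = tt ; 1∈ = tt ; +∈ = λ _ _ → tt ; -∈ = λ _ → tt ; *∈ = λ _ _ → tt ; inv∈ = λ _ _ → tt }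

  module LK = LinearAlgebra L _≟_ K subfield searchable-K
  module LL = LinearAlgebra L _≟_ (All L) all-subfield searchable-L

module QSystems (L : Field) (K : Scalars L) (q n : ℕ) (ext : IsExtension L K q n) where
  open Vectors L
  open FiniteExtension L K q n ext

  U : ∀ {k t} → (Fin k → Vec t) → Vec k → Set
  U = QSystem L K

  dot : ∀ {k} → Vec k → Vec k → Carrier
  dot a u = sum (λ i → a i * u i)

  dot-linear : ∀ {k} (a : Vec k) → IsLinear (λ u (_ : Fin 1) → dot a u)
  dot-linear {k} a = record
    { cong   = λ u≈v _ → sum-cong {k} (λ i → *-congˡ (u≈v i))
    ; +-homo = λ u v _ → trans (sum-cong {k} (λ i → distribˡ _ _ _)) (∑-distrib-+ {k} _ _)
    ; ·-homo = λ c u _ → trans (sum-cong {k} (λ i → x*yz≈y*xz (a i) c (u i))) (sym (*-distribˡ-sum {k} c (λ i → a i * u i))) }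

  L⇒K-subspace : ∀ {t} {W : Vec t → Set} → LL.Subspace W → LK.Subspace W
  L⇒K-subspace W-sub = record { resp = resp ; zero∈ = zero∈ ; +∈ = +∈ ; ·∈ = λ _ → ·∈ tt }
    where open IsSubspace W-sub

  unit-spans : ∀ {k} (x : Vec k) → LL.Span unit x
  unit-spans x = x , (λ _ → tt) , λ r → sym (trans (lc-sum x unit r) (sum-unitʳ r x))

  unit-indep : ∀ {k} → LL.Indep (unit {k})
  unit-indep c _ lc≈0 l = trans (sym (sum-unitʳ l c)) (trans (sym (lc-sum c unit l)) (lc≈0 l))

  unit-inject≤ : ∀ {δ k} (δ≤k : δ ≤ k) (a b : Fin δ) → unit (inject≤ a δ≤k) (inject≤ b δ≤k) ≡ unit a b
  unit-inject≤ {suc δ} {suc k} δ≤k       zero    zero    = ≡.refl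
  unit-inject≤ {suc δ} {suc k} δ≤k       zero    (suc b) = ≡.refl
  unit-inject≤ {suc δ} {suc k} δ≤k       (suc a) zero    = ≡.refl
  unit-inject≤ {suc δ} {suc k} (s≤s δ≤k) (suc a) (suc b) = unit-inject≤ δ≤k a b

  unit-inject≤-indep : ∀ {δ k} (δ≤k : δ ≤ k) → LL.Indep (λ l → unit (inject≤ l δ≤k))
  unit-inject≤-indep {δ} δ≤k c _ lc≈0 l = begin
    c l                                                    ≈⟨ sym (sum-unitʳ l c) ⟩
    sum (λ l′ → c l′ * unit l′ l)                          ≈⟨ sum-cong {δ} (λ l′ → *-congˡ (sym (≡⇒≈ (unit-inject≤ δ≤k l′ l)))) ⟩
    sum (λ l′ → c l′ * unit (inject≤ l′ δ≤k) (inject≤ l δ≤k)) ≈⟨ sym (lc-sum c _ (inject≤ l δ≤k)) ⟩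
    lc c (λ l′ → unit (inject≤ l′ δ≤k)) (inject≤ l δ≤k)       ≈⟨ lc≈0 (inject≤ l δ≤k) ⟩
    0#                                                     ∎

  annihilator : ∀ {δ k} (β : Fin δ → Vec k) → δ < k → ∃ λ a → ¬ a ≈v 0v × (∀ l → dot a (β l) ≈ 0#)
  annihilator {δ} β δ<k with LL.indep⊎dep (transpose β)
  ... | inj₁ indep = ⊥-elim (ℕ.<⇒≱ δ<k (LL.steinitz δ (transpose β) unit indep (unit-spans ∘ transpose β)))
  ... | inj₂ (a , _ , lc≈0 , i , ai≉0) = a , (λ a≈0 → ai≉0 (a≈0 i)) , λ l → trans (sym (lc-sum a (transpose β) l)) (lc≈0 l)

  annihilates-span : ∀ {δ k} (a : Vec k) (β : Fin δ → Vec k) → (∀ l → dot a (β l) ≈ 0#) → ∀ {x} → LL.Span β x → dot a x ≈ 0#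
  annihilates-span a β aβ≈0 (c , _ , x≈) =
    trans (IsLinear.cong (dot-linear a) x≈ zero) (trans (linear-lc (dot-linear a) c β zero) (lc-zeroʳ c (λ l _ → aβ≈0 l) zero))

  module GenMatrix {k t} {C : Vec t → Set} {G : Fin k → Vec t} (G-gen : IsGenMatrix L K C G) where

    rows-indep : LL.Indep G
    rows-indep = proj₁ G-gen

    columns-indep : LK.Indep (transpose G)
    columns-indep = proj₂ (proj₂ (proj₂ G-gen))

    lc∈C : ∀ a → C (lc a G)
    lc∈C a = proj₁ (proj₂ (proj₂ G-gen)) _ (a , (λ _ → tt) , ≈v-refl)

    C⊆span : ∀ x → C x → LL.Span G x
    C⊆span = proj₁ (proj₂ G-gen)

    rows∈C : ∀ i → C (G i)
    rows∈C i = proj₁ (proj₂ (proj₂ G-gen)) (G i) (LL.span-member G i)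

  codeword-nonzero : ∀ {k t} (G : Fin k → Vec t) → LL.Indep G → ∀ {a} → ¬ a ≈v 0v → NonZeroV L (lc a G)
  codeword-nonzero G G-indep a≉0 aG≈0 = a≉0 (G-indep _ (λ _ → tt) aG≈0)

  U-dim : ∀ {k t} (G : Fin k → Vec t) → LK.Indep (transpose G) → LK.Dim (U G) t
  U-dim G G-cols = LK.dim-span (transpose G) G-cols

  Achieves : ∀ {k t} → (Fin k → Vec t) → ℕ → ℕ → Set₁
  Achieves {k} G δ e = ∃ λ (H : Vec k → Set) → LL.Subspace H × LL.Dim H δ × LK.Dim (U G ∩ H) e

  MaxDim : ∀ {k t} → (Fin k → Vec t) → ℕ → ℕ → Set₁
  MaxDim {t = t} G δ E = Achieves G δ E × (∀ e → Achieves G δ e → e ≤ E) × E ≤ t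

  achieves≤t : ∀ {k t δ e} (G : Fin k → Vec t) → Achieves G δ e → e ≤ t
  achieves≤t {t = t} G (_ , _ , _ , σ , Uσ , σ-indep , _) = LK.steinitz t σ (transpose G) σ-indep (proj₁ ∘ Uσ)

  achieves-whole-space : ∀ {k t} (G : Fin k → Vec t) → LK.Indep (transpose G) → Achieves G k t
  achieves-whole-space G G-cols = (λ _ → ⊤) , record { resp = λ _ _ → tt ; zero∈ = tt ; +∈ = λ _ _ → tt ; ·∈ = λ _ _ → tt } ,
    (unit , (λ _ → tt) , unit-indep , λ x _ → unit-spans x) ,
    (transpose G , (λ j → LK.span-member (transpose G) j , tt) , G-cols , λ x → proj₁)

  -- If every column of G lay in the proper subspace H, a nonzero functional vanishing
  -- on H would vanish on all columns, i.e. give a vanishing combination of the rows.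
  achieves-suc : ∀ {k t δ e} (G : Fin k → Vec t) → LL.Indep G → (H : Vec k → Set) → LL.Subspace H → LL.Dim H δ → δ < k →
    LK.Dim (U G ∩ H) e → ∃ λ e′ → Achieves G (suc δ) e′ × suc e ≤ e′
  achieves-suc {k} G G-indep H H-sub (β , Hβ , β-indep , β-spans) δ<k (σ , Uσ , σ-indep , _)
    with any? (λ j → ¬? (LL.subspace? H-sub β (Hβ , β-indep , β-spans) (transpose G j)))
  ... | no none = ⊥-elim (a≉0 (G-indep a (λ _ → tt) aG≈0))
    where
    a = proj₁ (annihilator β δ<k)
    a≉0 = proj₁ (proj₂ (annihilator β δ<k))
    columns∈H : ∀ j → H (transpose G j)
    columns∈H j = decidable-stable (LL.subspace? H-sub β (Hβ , β-indep , β-spans) (transpose G j)) (λ ∉H → none (j , ∉H))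
    aG≈0 : lc a G ≈v 0v
    aG≈0 j = trans (lc-sum a G j) (annihilates-span a β (proj₂ (proj₂ (annihilator β δ<k))) (β-spans _ (columns∈H j)))
  ... | yes (j₀ , column∉H) = e′ , (H′ , LL.span-subspace β′ , LL.dim-span β′ β′-indep , ∩-dim) ,
                               LK.indep≤dim (v₀ ∷ σ) v₀σ-indep (All-∷ {P = U G ∩ H′} Uv₀ Uσ′) ∩-dim
    where
    v₀ = transpose G j₀
    β′ = v₀ ∷ β
    H′ = LL.Span β′
    β′-indep : LL.Indep β′
    β′-indep = LL.indep-∷ β-indep (column∉H ∘ LL.subspace-span H-sub β Hβ)
    ∩-exists = LK.dim-exists (U G ∩ H′) (LK.subspace-∩ (LK.span-subspace (transpose G)) (L⇒K-subspace (LL.span-subspace β′)))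
                 (λ x → LK.span? (transpose G) x ×-dec LL.span? β′ x) (transpose G) (λ _ → proj₁)
    e′ = proj₁ ∩-exists
    ∩-dim = proj₂ ∩-exists
    v₀σ-indep : LK.Indep (v₀ ∷ σ)
    v₀σ-indep = LK.indep-∷ σ-indep (column∉H ∘ LK.subspace-span (L⇒K-subspace H-sub) σ (proj₂ ∘ Uσ))
    Uv₀ : (U G ∩ H′) v₀
    Uv₀ = LK.span-member (transpose G) j₀ , LL.span-member β′ zero
    Uσ′ : ∀ i → (U G ∩ H′) (σ i)
    Uσ′ i = proj₁ (Uσ i) , LL.span-trans {w = β′} (LL.span-member β′ ∘ suc) (β-spans (σ i) (proj₂ (Uσ i)))

  -- Writing G′ = A G and G = B G′, the map u ↦ A u sends the columns of G to those of G′
  -- and is injective since B A = 1; it carries U G ∩ H onto U G′ ∩ A H.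
  module _ {k t} {C : Vec t → Set} {G G′ : Fin k → Vec t} (G-gen : IsGenMatrix L K C G) (G′-gen : IsGenMatrix L K C G′) where
    private
      G′∈G : ∀ i → LL.Span G (G′ i)
      G′∈G i = GenMatrix.C⊆span G-gen (G′ i) (GenMatrix.rows∈C G′-gen i)
      G∈G′ : ∀ l → LL.Span G′ (G l)
      G∈G′ l = GenMatrix.C⊆span G′-gen (G l) (GenMatrix.rows∈C G-gen l)
      A B : Fin k → Vec k
      A i = proj₁ (G′∈G i)
      B l = proj₁ (G∈G′ l)
      φ : Vec k → Vec k
      φ u i = dot (A i) u
      φ-linear : IsLinear φ
      φ-linear = record
        { cong   = λ u≈v i → IsLinear.cong (dot-linear (A i)) u≈v zero
        ; +-homo = λ u v i → IsLinear.+-homo (dot-linear (A i)) u v zero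
        ; ·-homo = λ c u i → IsLinear.·-homo (dot-linear (A i)) c u zero }
      φ-columns : ∀ j → transpose G′ j ≈v φ (transpose G j)
      φ-columns j i = trans (proj₂ (proj₂ (G′∈G i)) j) (lc-sum (A i) G j)
      BA : Fin k → Vec k
      BA l r = sum (λ i → B l i * A i r)
      BA≈1 : ∀ l r → BA l r ≈ unit l r
      BA≈1 l r = x∙y⁻¹≈ε⇒x≈y _ _ (GenMatrix.rows-indep G-gen (λ r → BA l r - unit l r) (λ _ → tt) BA-1≈0 r)
        where
        BA-1≈0 : lc (λ r → BA l r - unit l r) G ≈v 0v
        BA-1≈0 j = begin
          lc (λ r → BA l r - unit l r) G j                ≈⟨ lc-+ˡ (BA l) (λ r → - unit l r) G j ⟩
          lc (BA l) G j + lc (λ r → - unit l r) G j       ≈⟨ +-cong (sym (lc-lc (B l) A G j)) (lc-negˡ (unit l) G j) ⟩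
          lc (B l) (λ i → lc (A i) G) j - lc (unit l) G j ≈⟨ +-cong (sym (lc-congʳ (proj₂ ∘ proj₂ ∘ G′∈G) j)) (-‿cong (lc-unit l G j)) ⟩
          lc (B l) G′ j - G l j                           ≈⟨ +-congʳ (sym (proj₂ (proj₂ (G∈G′ l)) j)) ⟩
          G l j - G l j                                   ≈⟨ -‿inverseʳ _ ⟩
          0#                                              ∎
      φ-kernel : ∀ u → φ u ≈v 0v → u ≈v 0v
      φ-kernel u φu≈0 l = begin
        u l                                               ≈⟨ sym (sum-unitˡ l u) ⟩
        sum (λ r → unit l r * u r)                        ≈⟨ sum-cong {k} (λ r → *-congʳ (sym (BA≈1 l r))) ⟩
        sum (λ r → BA l r * u r)                          ≈⟨ sum-cong {k} (λ r → *-distribʳ-sum (u r) (λ i → B l i * A i r)) ⟩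
        sum (λ r → sum (λ i → B l i * A i r * u r))       ≈⟨ sym (∑-comm {k} {k} (λ i r → B l i * A i r * u r)) ⟩
        sum (λ i → sum (λ r → B l i * A i r * u r))       ≈⟨ sum-cong {k} (λ i → trans (sum-cong {k} (λ r → *-assoc _ _ _))
                                                              (sym (*-distribˡ-sum {k} (B l i) (λ r → A i r * u r)))) ⟩
        sum (λ i → B l i * φ u i)                         ≈⟨ sum-zero {k} (λ i → trans (*-congˡ (φu≈0 i)) (zeroʳ _)) ⟩
        0#                                                ∎
      φ-injective : ∀ x y → φ x ≈v φ y → x ≈v y
      φ-injective x y φx≈φy j = x∙y⁻¹≈ε⇒x≈y _ _ (φ-kernel (x +v -v y)
        (λ i → trans (IsLinear.+-homo φ-linear x (-v y) i) (trans (+-congˡ (linear-neg φ-linear y i))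
          (trans (+-congʳ (φx≈φy i)) (-‿inverseʳ _)))) j)

    achieves-transfer : ∀ {δ e} → Achieves G δ e → Achieves G′ δ e
    achieves-transfer (H , H-sub , (β , Hβ , β-indep , β-spans) , (σ , Uσ , σ-indep , σ-spans)) =
      LL.Span (φ ∘ β) , LL.span-subspace (φ ∘ β) , LL.dim-span (φ ∘ β) φβ-indep , (φ ∘ σ , Uφσ , φσ-indep , φσ-spans)
      where
      φβ-indep : LL.Indep (φ ∘ β)
      φβ-indep c Sc lc≈0 = β-indep c Sc (φ-kernel _ (≈v-trans (linear-lc φ-linear c β) lc≈0))
      φσ-indep : LK.Indep (φ ∘ σ)
      φσ-indep c Sc lc≈0 = σ-indep c Sc (φ-kernel _ (≈v-trans (linear-lc φ-linear c σ) lc≈0))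
      φ-preserves-U : ∀ {x} → U G x → U G′ (φ x)
      φ-preserves-U (c , Kc , x≈) = c , Kc ,
        ≈v-trans (IsLinear.cong φ-linear x≈) (≈v-trans (linear-lc φ-linear c (transpose G)) (lc-congʳ (≈v-sym ∘ φ-columns)))
      φ-preserves-span : ∀ {x} → LL.Span β x → LL.Span (φ ∘ β) (φ x)
      φ-preserves-span (c , Sc , x≈) = c , Sc , ≈v-trans (IsLinear.cong φ-linear x≈) (linear-lc φ-linear c β)
      Uφσ : ∀ i → (U G′ ∩ LL.Span (φ ∘ β)) (φ (σ i))
      Uφσ i = φ-preserves-U (proj₁ (Uσ i)) , φ-preserves-span (β-spans (σ i) (proj₂ (Uσ i)))
      φσ-spans : ∀ y → (U G′ ∩ LL.Span (φ ∘ β)) y → LK.Span (φ ∘ σ) y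
      φσ-spans y ((c , Kc , y≈) , (c′ , _ , y≈′)) =
        μ , Kμ , ≈v-trans y≈φx (≈v-trans (IsLinear.cong φ-linear (proj₂ (proj₂ x∈σ))) (linear-lc φ-linear μ σ))
        where
        x = lc c (transpose G)
        y≈φx : y ≈v φ x
        y≈φx = ≈v-trans y≈ (≈v-trans (lc-congʳ φ-columns) (≈v-sym (linear-lc φ-linear c (transpose G))))
        x≈β : x ≈v lc c′ β
        x≈β = φ-injective x (lc c′ β) (≈v-trans (≈v-sym y≈φx) (≈v-trans y≈′ (≈v-sym (linear-lc φ-linear c′ β))))
        x∈σ = σ-spans x ((c , Kc , ≈v-refl) , IsSubspace.resp H-sub (≈v-sym x≈β) (LL.subspace-lc H-sub β Hβ c′ (λ _ → tt)))
        μ = proj₁ x∈σ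
        Kμ = proj₁ (proj₂ x∈σ)

  -- The maximum is found by bounded search over coordinates: β spans an L-subspace and
  -- g gives e vectors of U by their K-coordinates with respect to the columns of G.
  module _ {k t} (G : Fin k → Vec t) {δ} (δ≤k : δ ≤ k) where
    private
      family : ∀ {e} → (Fin e → Fin t → Carrier) → Fin e → Vec k
      family g i = lc (g i) (transpose G)

      Fits : ∀ e → (Fin δ → Vec k) → (Fin e → Fin t → Carrier) → Set
      Fits e β g = LK.Indep (family g) × (∀ i → LL.Span β (family g i))

      Good : ℕ → (Fin δ → Vec k) → Set
      Good e β = LL.Indep β × ∃ λ g → (∀ i j → K (g i j)) × Fits e β g

      Witness : ℕ → Set
      Witness e = ∃ (Good e)

      fits-resp : ∀ {e β g g′} → (∀ i j → g i j ≈ g′ i j) → Fits e β g → Fits e β g′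
      fits-resp g≈ (g-indep , g∈β) = LK.indep-resp (λ i → lc-congˡ (g≈ i)) g-indep , λ i → LL.span-resp (lc-congˡ (g≈ i)) (g∈β i)

      good-resp : ∀ {e β β′} → (∀ l i → β l i ≈ β′ l i) → Good e β → Good e β′
      good-resp β≈ (β-indep , g , Kg , g-indep , g∈β) = LL.indep-resp β≈ β-indep , g , Kg , g-indep , λ i → LL.span-resp-family β≈ (g∈β i)

      witness? : ∀ e → Dec (Witness e)
      witness? e = map′ (λ (β , _ , good) → β , good) (λ (β , good) → β , (λ _ _ → tt) , good)
        (searchable-Vector (λ _ → refl) (LL.search-coefficients k) δ (Good e) good-resp λ β →
          LL.indep? β ×-dec searchable-Vector (λ _ → refl) (LK.search-coefficients t) e (Fits e β) fits-resp λ g →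
            LK.indep? (family g) ×-dec all? (λ i → LL.span? β (family g i)))

      witness-0 : Witness 0
      witness-0 = (λ l → unit (inject≤ l δ≤k)) , unit-inject≤-indep δ≤k , (λ ()) , (λ ()) , LK.indep-[] (λ ()) , λ ()

      witness≤t : ∀ e → Witness e → e ≤ t
      witness≤t e (_ , _ , g , Kg , g-indep , _) = LK.steinitz t (family g) (transpose G) g-indep (λ i → g i , Kg i , ≈v-refl)

      witness : ∀ {e} → Achieves G δ e → Witness e
      witness (_ , _ , (β , _ , β-indep , β-spans) , (σ , Uσ , σ-indep , _)) =
        β , β-indep , (λ i → proj₁ (proj₁ (Uσ i))) , (λ i → proj₁ (proj₂ (proj₁ (Uσ i)))) ,
        LK.indep-resp (λ i → proj₂ (proj₂ (proj₁ (Uσ i)))) σ-indep ,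
        λ i → LL.span-resp (proj₂ (proj₂ (proj₁ (Uσ i)))) (β-spans (σ i) (proj₂ (Uσ i)))

    maxDim-search : ∃ (MaxDim G δ)
    maxDim-search with bounded-maximum Witness witness? witness-0 t witness≤t
    ... | E , (β , β-indep , g , Kg , g-indep , g∈β) , maximal =
      E , (H , LL.span-subspace β , LL.dim-span β β-indep , ≡.subst (LK.Dim (U G ∩ H)) e≡E ∩-dim) ,
      (λ e → maximal e ∘ witness) , witness≤t E (β , β-indep , g , Kg , g-indep , g∈β)
      where
      H = LL.Span β
      ∩-exists = LK.dim-exists (U G ∩ H) (LK.subspace-∩ (LK.span-subspace (transpose G)) (L⇒K-subspace (LL.span-subspace β)))
                   (λ x → LK.span? (transpose G) x ×-dec LL.span? β x) (transpose G) (λ _ → proj₁)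
      ∩-dim = proj₂ ∩-exists
      e≡E : proj₁ ∩-exists ≡ E
      e≡E = ℕ.≤-antisym (maximal _ (witness (H , LL.span-subspace β , LL.dim-span β β-indep , ∩-dim)))
                        (LK.indep≤dim (family g) g-indep (λ i → (g i , Kg i , ≈v-refl) , g∈β i) ∩-dim)

  abstract
    maxDim-exists : ∀ {k t} (G : Fin k → Vec t) → ∀ δ → δ ≤ k → ∃ (MaxDim G δ)
    maxDim-exists G δ δ≤k = maxDim-search G δ≤k

  module _ {k t} {G : Fin k → Vec t} where

    maxDim-unique : ∀ {δ E E′} → MaxDim G δ E → MaxDim G δ E′ → E ≡ E′
    maxDim-unique (achE , maxE , _) (achE′ , maxE′ , _) = ℕ.≤-antisym (maxE′ _ achE) (maxE _ achE′)

    maxDim-suc : ∀ {δ E E′} → LL.Indep G → δ < k → MaxDim G δ E → MaxDim G (suc δ) E′ → suc E ≤ E′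
    maxDim-suc G-indep δ<k ((H , H-sub , H-dim , ∩-dim) , _) (_ , maxE′ , _)
      with achieves-suc G G-indep H H-sub H-dim δ<k ∩-dim
    ... | e′ , ach′ , suc-E≤e′ = ℕ.≤-trans suc-E≤e′ (maxE′ e′ ach′)

    maxDim-+ : ∀ {δ E E′} → LL.Indep G → ∀ d → δ ℕ.+ d ≤ k → MaxDim G δ E → MaxDim G (δ ℕ.+ d) E′ → E ℕ.+ d ≤ E′
    maxDim-+ {δ} {E} {E′} G-indep zero δ≤k maxδ maxδ′ = ℕ.≤-reflexive (≡.trans (ℕ.+-identityʳ E)
      (maxDim-unique maxδ (≡.subst (λ δ′ → MaxDim G δ′ E′) (ℕ.+-identityʳ δ) maxδ′)))
    maxDim-+ {δ} {E} {E′} G-indep (suc d) δ+d<k maxδ maxδ′ =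
      let δ+d<k′ = ≡.subst (_≤ k) (ℕ.+-suc δ d) δ+d<k
          (E″ , maxδ″) = maxDim-exists G (δ ℕ.+ d) (ℕ.<⇒≤ δ+d<k′)
      in ≡.subst (_≤ E′) (≡.sym (ℕ.+-suc E d))
           (ℕ.≤-trans (s≤s (maxDim-+ G-indep d (ℕ.<⇒≤ δ+d<k′) maxδ maxδ″))
                      (maxDim-suc G-indep δ+d<k′ maxδ″ (≡.subst (λ δ′ → MaxDim G δ′ E′) (ℕ.+-suc δ d) maxδ′)))

  maxDim-invariant : ∀ {k t δ E E′} {C : Vec t → Set} {G G′ : Fin k → Vec t} → IsGenMatrix L K C G → IsGenMatrix L K C G′ →
    MaxDim G δ E → MaxDim G′ δ E′ → E ≡ E′
  maxDim-invariant G-gen G′-gen (achE , maxE , _) (achE′ , maxE′ , _) =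
    ℕ.≤-antisym (maxE′ _ (achieves-transfer G-gen G′-gen achE)) (maxE _ (achieves-transfer G′-gen G-gen achE′))

  MaxDim⇒GRW : ∀ {k t ρ E} {C : Vec t → Set} {G : Fin k → Vec t} → IsGenMatrix L K C G → MaxDim G (k ∸ ρ) E →
    GRW L K C k ρ (t ∸ E)
  MaxDim⇒GRW {t = t} {E = E} {G = G} G-gen ((H , H-sub , H-dim , ∩-dim) , maxE , E≤t) =
    G , G-gen , (H , H-sub , H-dim , E , ∩-dim , ℕ.m+[n∸m]≡n E≤t) ,
    λ H′ H′-sub H′-dim e ∩′-dim → ≡.subst (e ℕ.+ (t ∸ E) ≤_) (ℕ.m+[n∸m]≡n E≤t)
      (ℕ.+-monoˡ-≤ (t ∸ E) (maxE e (H′ , H′-sub , H′-dim , ∩′-dim)))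

  GRW⇒MaxDim : ∀ {k t ρ w E} {C : Vec t → Set} (gr : GRW L K C k ρ w) → MaxDim (proj₁ gr) (k ∸ ρ) E → E ℕ.+ w ≡ t
  GRW⇒MaxDim {w = w} (G , _ , (H₀ , H₀-sub , H₀-dim , e₀ , ∩₀-dim , e₀+w≡t) , bounded) ((H , H-sub , H-dim , ∩-dim) , maxE , _) =
    ℕ.≤-antisym (bounded H H-sub H-dim _ ∩-dim)
                (≡.subst (_≤ _) e₀+w≡t (ℕ.+-monoˡ-≤ w (maxE e₀ (H₀ , H₀-sub , H₀-dim , ∩₀-dim))))

  GRW-value : ∀ {k t ρ w E} {C : Vec t → Set} {G : Fin k → Vec t} → IsGenMatrix L K C G → MaxDim G (k ∸ ρ) E →
    GRW L K C k ρ w → E ℕ.+ w ≡ t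
  GRW-value {k} {ρ = ρ} {w} G-gen maxE gr@(G′ , G′-gen , _) with maxDim-exists G′ (k ∸ ρ) (ℕ.m∸n≤m k ρ)
  ... | E′ , maxE′ = ≡.trans (≡.cong (ℕ._+ w) (maxDim-invariant G-gen G′-gen maxE maxE′)) (GRW⇒MaxDim {ρ = ρ} gr maxE′)

module IntersectionBounds (L : Field) (K : Scalars L) (q n : ℕ) (ext : IsExtension L K q n) where
  open Arithmetic
  open Vectors L
  open FiniteExtension L K q n ext
  open QSystems L K q n ext

  -- u ↦ a·u maps U G K-linearly onto the K-span of the entries of the codeword a G.
  rank-nullity-codeword : ∀ {k t u} (G : Fin k → Vec t) → LK.Dim (U G) u → (a : Vec k) →
    ∃₂ λ p r → LK.Dim (U G ∩ λ x → dot a x ≈ 0#) p × RankWeight L K (lc a G) r × p ℕ.+ r ≡ u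
  rank-nullity-codeword {k} G (b , Ub , b-indep , b-spans) a =
    p , r , LK.dim-resp (λ _ (Ux , ax≈0) → Ux , ax≈0 zero) (λ _ (Ux , ax≈0) → Ux , λ _ → ax≈0) ker-dim ,
    LK.dim-resp (λ _ → LK.span-trans image⊆entries) (λ _ → LK.span-trans entries⊆image) im-dim , p+r≡u
    where
    split = LK.rank-nullity (LK.span-subspace (transpose G)) (dot-linear a) b (Ub , b-indep , b-spans)
    p = proj₁ split
    r = proj₁ (proj₂ split)
    ker-dim = proj₁ (proj₂ (proj₂ split))
    im-dim = proj₁ (proj₂ (proj₂ (proj₂ split)))
    p+r≡u = proj₂ (proj₂ (proj₂ (proj₂ split)))
    a· : Vec k → Vec 1
    a· x _ = dot a x
    image⊆entries : ∀ i → LK.Span (λ j _ → lc a G j) (a· (b i))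
    image⊆entries i = let (c , Kc , bi≈) = Ub i in c , Kc ,
      ≈v-trans (IsLinear.cong (dot-linear a) bi≈) (≈v-trans (linear-lc (dot-linear a) c (transpose G))
        (lc-congʳ (λ j _ → sym (lc-sum a G j))))
    entries⊆image : ∀ j → LK.Span (a· ∘ b) (λ _ → lc a G j)
    entries⊆image j = let (c , Kc , col≈) = b-spans (transpose G j) (LK.span-member (transpose G) j) in c , Kc ,
      ≈v-trans (λ _ → lc-sum a G j) (≈v-trans (IsLinear.cong (dot-linear a) col≈) (linear-lc (dot-linear a) c b))

  module _ {k t u d} (C : Vec t → Set) (G : Fin (suc k) → Vec t) (G-indep : LL.Indep G) (G∈C : ∀ a → C (lc a G))
           (U-dim : LK.Dim (U G) u) (C-dist : MinDist L K C d) where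

    -- A hyperplane is the kernel of a nonzero functional a, and the codeword a G has rank at least d.
    hyperplane-bound : ∀ {e} → Achieves G k e → e ℕ.+ d ≤ u
    hyperplane-bound {e} (H , _ , (β , _ , _ , β-spans) , ∩-dim) = ≡.subst (e ℕ.+ d ≤_) p+r≡u (ℕ.+-mono-≤ e≤p d≤r)
      where
      functional = annihilator β (ℕ.n<1+n k)
      a = proj₁ functional
      split = rank-nullity-codeword G U-dim a
      p = proj₁ split
      r = proj₁ (proj₂ split)
      p+r≡u = proj₂ (proj₂ (proj₂ (proj₂ split)))
      e≤p : e ≤ p
      e≤p = LK.dim-mono (λ x (Ux , Hx) → Ux , annihilates-span a β (proj₂ (proj₂ functional)) (β-spans x Hx))
              ∩-dim (proj₁ (proj₂ (proj₂ split)))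
      d≤r : d ≤ r
      d≤r = proj₂ C-dist (lc a G) r (G∈C a) (codeword-nonzero G G-indep (proj₁ (proj₂ functional)))
              (proj₁ (proj₂ (proj₂ (proj₂ split))))

    ∩-dim-bound : ∀ d′ {δ e} → δ ℕ.+ d′ ≡ k → Achieves G δ e → e ℕ.+ d′ ℕ.+ d ≤ u
    ∩-dim-bound zero {δ} {e} δ+0≡k ach = ≡.subst (λ x → x ℕ.+ d ≤ u) (≡.sym (ℕ.+-identityʳ e))
      (hyperplane-bound (≡.subst (λ δ′ → Achieves G δ′ e) (≡.trans (≡.sym (ℕ.+-identityʳ δ)) δ+0≡k) ach))
    ∩-dim-bound (suc d′) {δ} {e} δ+d′≡k (H , H-sub , H-dim , ∩-dim) =
      ℕ.≤-trans (ℕ.+-monoˡ-≤ d (≡.subst (_≤ e′ ℕ.+ d′) (≡.sym (ℕ.+-suc e d′)) (ℕ.+-monoˡ-≤ d′ (proj₂ (proj₂ step)))))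
                (∩-dim-bound d′ (≡.trans (≡.sym (ℕ.+-suc δ d′)) δ+d′≡k) (proj₁ (proj₂ step)))
      where
      step = achieves-suc G G-indep H H-sub H-dim (s≤s (≡.subst (δ ≤_) δ+d′≡k (ℕ.m≤m+n δ (suc d′)))) ∩-dim
      e′ = proj₁ step

  achieves-0 : ∀ {k t} (G : Fin k → Vec t) → Achieves G 0 0
  achieves-0 G = LL.Span (λ ()) , LL.span-subspace (λ ()) , LL.dim-span (λ ()) (LL.indep-[] (λ ())) ,
    (λ ()) , (λ ()) , LK.indep-[] (λ ()) , λ x (_ , x∈0) → (λ ()) , (λ ()) , proj₂ (proj₂ x∈0)

  -- A dependent column lies in the K-span of the others, so dim U < t,
  -- whereas the bound for H = 0 gives dim U ≥ h + (t - h).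
  MRD-nondegenerate : ∀ {h t} (C : Vec t → Set) (G : Fin (suc h) → Vec t) → LL.Indep G → (∀ a → C (lc a G)) →
    MinDist L K C (t ∸ h) → suc h ≤ t → LK.Indep (transpose G)
  MRD-nondegenerate {h} {zero} _ _ _ _ _ ()
  MRD-nondegenerate {h} {suc t} C G G-indep G∈C C-dist h<t with LK.indep⊎dep (transpose G)
  ... | inj₁ indep = indep
  ... | inj₂ (c , Kc , lc≈0 , j₀ , c≉0) = ⊥-elim (ℕ.<⇒≱ (s≤s u≤t) t+1≤u)
    where
    U-exists = LK.dim-exists (U G) (LK.span-subspace (transpose G)) (LK.span? (transpose G)) (transpose G) (λ _ x∈ → x∈)
    u = proj₁ U-exists
    columns⊆others : ∀ j → LK.Span (removeAt (transpose G) j₀) (transpose G j)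
    columns⊆others j with j₀ Fin.≟ j
    ... | yes ≡.refl = LK.span-removeAt {v = transpose G} c Kc lc≈0 j₀ c≉0
    ... | no j₀≢j = ≡.subst (LK.Span _ ∘ transpose G) (punchIn-punchOut j₀≢j) (LK.span-member _ (punchOut j₀≢j))
    u≤t : u ≤ t
    u≤t = let (b , Ub , b-indep , _) = proj₂ U-exists in
          LK.steinitz t b (removeAt (transpose G) j₀) b-indep (λ i → LK.span-trans columns⊆others (Ub i))
    t+1≤u : suc t ≤ u
    t+1≤u = ≡.subst (_≤ u) (ℕ.m+[n∸m]≡n (ℕ.m≤n⇒m≤1+n (ℕ.≤-pred h<t)))
      (∩-dim-bound C G G-indep G∈C (proj₂ U-exists) C-dist h ≡.refl (achieves-0 G))

  MRD-∩-bound : ∀ {h t} (C : Vec t → Set) (G : Fin (suc h) → Vec t) → LL.Indep G → (∀ a → C (lc a G)) →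
    LK.Indep (transpose G) → MinDist L K C (t ∸ h) → h ≤ t → ∀ {δ e} → δ ≤ h → Achieves G δ e → e ≤ δ
  MRD-∩-bound {h} C G G-indep G∈C G-cols C-dist h≤t {δ} δ≤h ach = l+[n∸m]+[o∸n]≤o⇒l≤m δ≤h h≤t
    (∩-dim-bound C G G-indep G∈C (U-dim G G-cols) C-dist (h ∸ δ) (ℕ.m+[n∸m]≡n δ≤h) ach)

module BlockDiagonal (L : Field) (K : Scalars L) (q n : ℕ) (ext : IsExtension L K q n) where
  open Arithmetic
  open Vectors L
  open FiniteExtension L K q n ext
  open QSystems L K q n ext

  module _ {k₁ k₂ t₁ t₂} {G₁ : Fin k₁ → Vec t₁} {G₂ : Fin k₂ → Vec t₂} where

    U-⊕⁻ : ∀ {z} → U (G₁ ⊕ G₂) z → U G₁ (take k₁ z) × U G₂ (drop k₁ z)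
    U-⊕⁻ z∈U = LK.span-⊕⁻ (LK.span-resp-family (λ j i → ≡⇒≈ (transpose-⊕ G₁ G₂ j i)) z∈U)

    U-⊕⁺ : ∀ {z} → U G₁ (take k₁ z) → U G₂ (drop k₁ z) → U (G₁ ⊕ G₂) z
    U-⊕⁺ z₁∈U z₂∈U = LK.span-resp-family (λ j i → sym (≡⇒≈ (transpose-⊕ G₁ G₂ j i))) (LK.span-⊕⁺ z₁∈U z₂∈U)

    columns-indep-⊕ : LK.Indep (transpose G₁) → LK.Indep (transpose G₂) → LK.Indep (transpose (G₁ ⊕ G₂))
    columns-indep-⊕ G₁-cols G₂-cols =
      LK.indep-resp (λ j i → sym (≡⇒≈ (transpose-⊕ G₁ G₂ j i))) (LK.indep-⊕ G₁-cols G₂-cols)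

    genMatrix-⊕ : ∀ {C₁ C₂} → IsGenMatrix L K C₁ G₁ → IsGenMatrix L K C₂ G₂ →
      IsGenMatrix L K (λ z → C₁ (take t₁ z) × C₂ (drop t₁ z)) (G₁ ⊕ G₂)
    genMatrix-⊕ (rows₁ , C₁⊆ , ⊆C₁ , cols₁) (rows₂ , C₂⊆ , ⊆C₂ , cols₂) =
      LL.indep-⊕ rows₁ rows₂ ,
      (λ z (z₁∈C₁ , z₂∈C₂) → LL.span-⊕⁺ (C₁⊆ _ z₁∈C₁) (C₂⊆ _ z₂∈C₂)) ,
      (λ z z∈span → let (z₁∈ , z₂∈) = LL.span-⊕⁻ z∈span in ⊆C₁ _ z₁∈ , ⊆C₂ _ z₂∈) ,
      columns-indep-⊕ cols₁ cols₂

  columns-indep-⨁ : ∀ {m k t} (Gs : Fin m → Fin k → Vec t) → (∀ i → LK.Indep (transpose (Gs i))) → LK.Indep (transpose (⨁ Gs))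
  columns-indep-⨁ {zero}  Gs Gs-cols = LK.indep-[] (λ ())
  columns-indep-⨁ {suc m} Gs Gs-cols = columns-indep-⊕ (Gs-cols zero) (columns-indep-⨁ (Gs ∘ suc) (Gs-cols ∘ suc))

  genMatrix-⨁ : ∀ {m k t} (Cs : Fin m → Vec t → Set) (Gs : Fin m → Fin k → Vec t) → (∀ i → IsGenMatrix L K (Cs i) (Gs i)) →
    IsGenMatrix L K (DirectSum L Cs) (⨁ Gs)
  genMatrix-⨁ {zero} Cs Gs Gs-gen = LL.indep-[] (λ ()) , (λ _ _ → (λ ()) , (λ ()) , (λ ())) , (λ _ _ ()) , LK.indep-[] (λ ())
  genMatrix-⨁ {suc m} {k} {t} Cs Gs Gs-gen with genMatrix-⊕ (Gs-gen zero) (genMatrix-⨁ (Cs ∘ suc) (Gs ∘ suc) (Gs-gen ∘ suc))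
  ... | rows , C⊆ , ⊆C , cols = rows , (λ z z∈C → C⊆ z (z∈C zero , z∈C ∘ suc)) , (λ z → blocks z ∘ ⊆C z) , cols
    where
    blocks : ∀ z → Cs zero (take t z) × DirectSum L (Cs ∘ suc) (drop t z) → DirectSum L Cs z
    blocks z (z₀∈C , _)    zero    = z₀∈C
    blocks z (_ , z′∈C) (suc i) = z′∈C i

  directSum-subspace : ∀ {m t} (Cs : Fin m → Vec t → Set) → (∀ i → LL.Subspace (Cs i)) → LL.Subspace (DirectSum L Cs)
  directSum-subspace Cs Cs-sub = record
    { resp  = λ x≈y x∈C i → IsSubspace.resp (Cs-sub i) (λ _ → x≈y _) (x∈C i)
    ; zero∈ = λ i → IsSubspace.zero∈ (Cs-sub i)
    ; +∈    = λ x∈C y∈C i → IsSubspace.+∈ (Cs-sub i) (x∈C i) (y∈C i)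
    ; ·∈    = λ Sa x∈C i → IsSubspace.·∈ (Cs-sub i) Sa (x∈C i) }

  -- Projecting onto the first block splits both H (over L) and U ∩ H (over K) by rank-nullity.
  ∩-⊕-split : ∀ {k₁ k₂ t₁ t₂} (G₁ : Fin k₁ → Vec t₁) (G₂ : Fin k₂ → Vec t₂) {δ e} → Achieves (G₁ ⊕ G₂) δ e →
    ∃₂ λ p r → p ℕ.+ r ≡ δ × ∃₂ λ a b → Achieves G₁ r a × Achieves G₂ p b × e ≤ b ℕ.+ a
  ∩-⊕-split {k₁} {k₂} G₁ G₂ {δ} {e} (H , H-sub , (β , Hβ , β-indep , β-spans) , (σ , Uσ , σ-indep , σ-spans)) =
    p , r , p+r≡δ , a , b , (πH , LL.span-subspace _ , πH-dim , ∩₁-dim) , (H′ , LL.span-subspace _ , H′-dim , ∩₂-dim) ,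
    ≡.subst (_≤ b ℕ.+ a) p′+r′≡e (ℕ.+-mono-≤ p′≤b r′≤a)
    where
    H-split = LL.rank-nullity H-sub (take-linear {k₁} {k₂}) β (Hβ , β-indep , β-spans)
    p = proj₁ H-split
    r = proj₁ (proj₂ H-split)
    κ = proj₁ (proj₁ (proj₂ (proj₂ H-split)))
    κ∈ker = proj₁ (proj₂ (proj₁ (proj₂ (proj₂ H-split))))
    κ-indep = proj₁ (proj₂ (proj₂ (proj₁ (proj₂ (proj₂ H-split)))))
    κ-spans = proj₂ (proj₂ (proj₂ (proj₁ (proj₂ (proj₂ H-split)))))
    πH-dim = proj₁ (proj₂ (proj₂ (proj₂ H-split)))
    p+r≡δ = proj₂ (proj₂ (proj₂ (proj₂ H-split)))
    ∩-split = LK.rank-nullity (LK.subspace-∩ (LK.span-subspace _) (L⇒K-subspace H-sub)) (take-linear {k₁} {k₂}) σ (Uσ , σ-indep , σ-spans)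
    p′ = proj₁ ∩-split
    r′ = proj₁ (proj₂ ∩-split)
    τ = proj₁ (proj₁ (proj₂ (proj₂ ∩-split)))
    τ∈ker = proj₁ (proj₂ (proj₁ (proj₂ (proj₂ ∩-split))))
    τ-indep = proj₁ (proj₂ (proj₂ (proj₁ (proj₂ (proj₂ ∩-split)))))
    πσ-dim = proj₁ (proj₂ (proj₂ (proj₂ ∩-split)))
    p′+r′≡e = proj₂ (proj₂ (proj₂ (proj₂ ∩-split)))
    πH = LL.Span (take k₁ ∘ β)
    H′ = LL.Span (drop k₁ ∘ κ)
    H′-dim : LL.Dim H′ p
    H′-dim = LL.dim-span _ (LL.indep-drop κ-indep (proj₂ ∘ κ∈ker))
    ∩₁-exists = LK.dim-exists (U G₁ ∩ πH) (LK.subspace-∩ (LK.span-subspace _) (L⇒K-subspace (LL.span-subspace _)))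
                  (λ x → LK.span? _ x ×-dec LL.span? _ x) (transpose G₁) (λ _ → proj₁)
    ∩₂-exists = LK.dim-exists (U G₂ ∩ H′) (LK.subspace-∩ (LK.span-subspace _) (L⇒K-subspace (LL.span-subspace _)))
                  (λ x → LK.span? _ x ×-dec LL.span? _ x) (transpose G₂) (λ _ → proj₁)
    a = proj₁ ∩₁-exists
    ∩₁-dim = proj₂ ∩₁-exists
    b = proj₁ ∩₂-exists
    ∩₂-dim = proj₂ ∩₂-exists
    πσ∈∩₁ : ∀ i → (U G₁ ∩ πH) (take k₁ (σ i))
    πσ∈∩₁ i = let (c , Sc , σi≈) = β-spans (σ i) (proj₂ (Uσ i)) in
      proj₁ (U-⊕⁻ (proj₁ (Uσ i))) , c , Sc , ≈v-trans (IsLinear.cong take-linear σi≈) (linear-lc take-linear c β)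
    r′≤a : r′ ≤ a
    r′≤a = LK.dim-mono (λ _ → LK.subspace-span (LK.subspace-∩ (LK.span-subspace _) (L⇒K-subspace (LL.span-subspace _))) _ πσ∈∩₁)
             πσ-dim ∩₁-dim
    τ∈∩₂ : ∀ l → (U G₂ ∩ H′) (drop k₁ (τ l))
    τ∈∩₂ l = let ((Uτ , Hτ) , πτ≈0) = τ∈ker l ; (c , Sc , τl≈) = κ-spans (τ l) (Hτ , πτ≈0) in
      proj₂ (U-⊕⁻ Uτ) , c , Sc , ≈v-trans (IsLinear.cong drop-linear τl≈) (linear-lc drop-linear c κ)
    p′≤b : p′ ≤ b
    p′≤b = LK.indep≤dim (drop k₁ ∘ τ) (LK.indep-drop τ-indep (proj₂ ∘ τ∈ker)) τ∈∩₂ ∩₂-dim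

  ⨁-∩-bound : ∀ {h t} → suc h ≤ t → ∀ m (Gs : Fin m → Fin (suc h) → Vec t) →
    (∀ i {δ e} → δ ≤ h → Achieves (Gs i) δ e → e ≤ δ) →
    ∀ {δ e} → Achieves (⨁ Gs) δ e → (δ ≤ h → e ≤ δ) × (δ ≡ suc h → e ≤ t)
  ⨁-∩-bound h<t zero Gs _ ach = (λ _ → ℕ.≤-trans (achieves≤t (⨁ Gs) ach) z≤n) , (λ _ → ℕ.≤-trans (achieves≤t (⨁ Gs) ach) z≤n)
  ⨁-∩-bound {h} {t} h<t (suc m) Gs blocks {δ} {e} ach = combine (∩-⊕-split (Gs zero) (⨁ (Gs ∘ suc)) ach)
    where
    combine : (∃₂ λ p r → p ℕ.+ r ≡ δ × ∃₂ λ a b → Achieves (Gs zero) r a × Achieves (⨁ (Gs ∘ suc)) p b × e ≤ b ℕ.+ a) →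
      (δ ≤ h → e ≤ δ) × (δ ≡ suc h → e ≤ t)
    combine (p , r , p+r≡δ , a , b , ach₁ , ach₂ , e≤b+a) = small , full
      where
      rest = ⨁-∩-bound h<t m (Gs ∘ suc) (blocks ∘ suc) ach₂
      small : δ ≤ h → e ≤ δ
      small δ≤h = ℕ.≤-trans e≤b+a (≡.subst (_ ≤_) p+r≡δ
        (ℕ.+-mono-≤ (proj₁ rest (ℕ.≤-trans (≡.subst (p ≤_) p+r≡δ (ℕ.m≤m+n p r)) δ≤h))
                    (blocks zero (ℕ.≤-trans (≡.subst (r ≤_) p+r≡δ (ℕ.m≤n+m r p)) δ≤h) ach₁)))
      full : δ ≡ suc h → e ≤ t
      full δ≡ = ℕ.≤-trans e≤b+a (two-block-bound p r h<t (≡.trans p+r≡δ δ≡) (λ r≤h → blocks zero r≤h ach₁)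
                                  (achieves≤t (Gs zero) ach₁) (proj₁ rest) (proj₂ rest))

  tail-achieves : ∀ m {k t} s (Gs : Fin m → Fin k → Vec t) → (∀ i → LK.Indep (transpose (Gs i))) →
    Achieves (⨁ Gs) ((m ∸ s) ℕ.* k) ((m ∸ s) ℕ.* t)
  tail-achieves zero    zero    Gs Gs-cols = achieves-whole-space (⨁ Gs) (columns-indep-⨁ Gs Gs-cols)
  tail-achieves zero    (suc s) Gs Gs-cols = achieves-whole-space (⨁ Gs) (columns-indep-⨁ Gs Gs-cols)
  tail-achieves (suc m) zero    Gs Gs-cols = achieves-whole-space (⨁ Gs) (columns-indep-⨁ Gs Gs-cols)
  tail-achieves (suc m) {k} (suc s) Gs Gs-cols = H₀ , H₀-sub , LL.dim-padˡ (IsSubspace.resp H-sub) H-dim ,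
    LK.dim-resp (λ _ (z₀≈0 , U′z , Hz) → U-⊕⁺ (LK.span-resp (≈v-sym z₀≈0) (LK.span-0 _)) U′z , z₀≈0 , Hz)
                (λ _ (Uz , z₀≈0 , Hz) → z₀≈0 , proj₂ (U-⊕⁻ Uz) , Hz)
                (LK.dim-padˡ (λ x≈y (U′x , Hx) → LK.span-resp x≈y U′x , IsSubspace.resp H-sub x≈y Hx) ∩-dim)
    where
    rest = tail-achieves m s (Gs ∘ suc) (Gs-cols ∘ suc)
    H = proj₁ rest
    H-sub = proj₁ (proj₂ rest)
    H-dim = proj₁ (proj₂ (proj₂ rest))
    ∩-dim = proj₂ (proj₂ (proj₂ rest))
    H₀ : Vec (suc m ℕ.* k) → Set
    H₀ z = take k z ≈v 0v × H (drop k z)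
    H₀-sub : LL.Subspace H₀
    H₀-sub = record
      { resp  = λ x≈y (x₀≈0 , Hx) → (λ i → trans (sym (x≈y _)) (x₀≈0 i)) , IsSubspace.resp H-sub (λ _ → x≈y _) Hx
      ; zero∈ = (λ _ → refl) , IsSubspace.zero∈ H-sub
      ; +∈    = λ (x₀≈0 , Hx) (y₀≈0 , Hy) → (λ i → trans (+-cong (x₀≈0 i) (y₀≈0 i)) (+-identityʳ _)) , IsSubspace.+∈ H-sub Hx Hy
      ; ·∈    = λ _ (x₀≈0 , Hx) → (λ i → trans (*-congˡ (x₀≈0 i)) (zeroʳ _)) , IsSubspace.·∈ H-sub tt Hx }

  directSum-minDist : ∀ {m t d} (Cs : Fin (suc m) → Vec t → Set) → (∀ i → LL.Subspace (Cs i)) →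
    (∀ i → MinDist L K (Cs i) d) → MinDist L K (DirectSum L Cs) d
  directSum-minDist {m} {t} {d} Cs Cs-sub Cs-dist = (z , z∈C , z≉0 , z-rank) , lower
    where
    x₀ = proj₁ (proj₁ (Cs-dist zero))
    z : Vec (suc m ℕ.* t)
    z = x₀ ++ 0v
    z∈C : DirectSum L Cs z
    z∈C zero    = IsSubspace.resp (Cs-sub zero) (≈v-sym (take-++ x₀ 0v)) (proj₁ (proj₂ (proj₁ (Cs-dist zero))))
    z∈C (suc i) = IsSubspace.resp (Cs-sub (suc i)) (λ j → sym (drop-++ x₀ 0v (Fin.combine i j))) (IsSubspace.zero∈ (Cs-sub (suc i)))
    z≉0 : NonZeroV L z
    z≉0 z≈0 = proj₁ (proj₂ (proj₂ (proj₁ (Cs-dist zero)))) (λ j → trans (sym (take-++ x₀ 0v j)) (z≈0 (j Fin.↑ˡ _)))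
    entries : ∀ {s} → Vec s → Fin s → Vec 1
    entries x j _ = x j
    z-rank : RankWeight L K z d
    z-rank = LK.dim-resp
      (λ _ → LK.span-trans λ j → LK.span-resp (λ _ → take-++ x₀ 0v j) (LK.span-member (entries z) (j Fin.↑ˡ _)))
      (λ _ → LK.span-trans (↑-elim (λ j → LK.Span (entries x₀) (entries z j))
        (λ j → LK.span-resp (λ _ → sym (take-++ x₀ 0v j)) (LK.span-member (entries x₀) j))
        (λ j → LK.span-resp (λ _ → sym (drop-++ x₀ 0v j)) (LK.span-0 (entries x₀)))))
      (proj₂ (proj₂ (proj₂ (proj₁ (Cs-dist zero)))))
    block : Vec (suc m ℕ.* t) → Fin (suc m) → Vec t
    block x i j = x (Fin.combine i j)
    lower : ∀ x r → DirectSum L Cs x → NonZeroV L x → RankWeight L K x r → d ≤ r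
    lower x r x∈C x≉0 x-rank with any? (λ i → ¬? (block x i LK.≈v? 0v))
    ... | no none = ⊥-elim (x≉0 λ l → let (i , j , ij≡l) = combine-surjective l in
                      ≡.subst (λ l → x l ≈ 0#) ij≡l (decidable-stable (block x i LK.≈v? 0v) (λ ≉0 → none (i , ≉0)) j))
    ... | yes (i , block≉0) = ℕ.≤-trans (proj₂ (Cs-dist i) (block x i) (proj₁ rank-exists) (x∈C i) block≉0 (proj₂ rank-exists))
                                  (LK.dim-mono (λ _ → LK.span-trans (LK.span-member (entries x) ∘ Fin.combine i)) (proj₂ rank-exists) x-rank)
      where
      rank-exists = LK.dim-exists (LK.Span (entries (block x i))) (LK.span-subspace _) (LK.span? _) (entries (block x i)) (λ _ y∈ → y∈)

module DirectSumOfMRD (m″ h n : ℕ) (h<n : suc h ≤ n) (L : Field) (K : Scalars L) (q : ℕ) (ext : IsExtension L K q n)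
                      (Cs : Fin (suc (suc m″)) → V L n → Set) (Cs-MRD : ∀ i → IsMRD L K n (Cs i) (suc h) (n ∸ h)) where
  open Arithmetic
  open Vectors L
  open FiniteExtension L K q n ext
  open QSystems L K q n ext
  open IntersectionBounds L K q n ext
  open BlockDiagonal L K q n ext

  m′ m k t : ℕ
  m′ = suc m″
  m  = suc m′
  k  = m ℕ.* suc h
  t  = m ℕ.* n

  C : Vec t → Set
  C = DirectSum L Cs

  Cs-sub : ∀ i → LL.Subspace (Cs i)
  Cs-sub i = proj₁ (proj₁ (proj₁ (Cs-MRD i)))

  Cs-dist : ∀ i → MinDist L K (Cs i) (n ∸ h)
  Cs-dist i = proj₂ (proj₁ (Cs-MRD i))

  Gs : Fin m → Fin (suc h) → Vec n
  Gs i = proj₁ (proj₂ (proj₁ (proj₁ (Cs-MRD i))))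

  Gs-basis : ∀ i → LL.IsBasis (Cs i) (Gs i)
  Gs-basis i = proj₂ (proj₂ (proj₁ (proj₁ (Cs-MRD i))))

  Gs∈C : ∀ i a → Cs i (lc a (Gs i))
  Gs∈C i a = LL.subspace-lc (Cs-sub i) (Gs i) (proj₁ (Gs-basis i)) a (λ _ → tt)

  Gs-cols : ∀ i → LK.Indep (transpose (Gs i))
  Gs-cols i = MRD-nondegenerate (Cs i) (Gs i) (proj₁ (proj₂ (Gs-basis i))) (Gs∈C i) (Cs-dist i) h<n

  Gs-gen : ∀ i → IsGenMatrix L K (Cs i) (Gs i)
  Gs-gen i = let (Gs∈ , Gs-indep , Gs-spans) = Gs-basis i in
    Gs-indep , Gs-spans , (λ _ → LL.subspace-span (Cs-sub i) (Gs i) Gs∈) , Gs-cols i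

  Gs-bound : ∀ i {δ e} → δ ≤ h → Achieves (Gs i) δ e → e ≤ δ
  Gs-bound i = MRD-∩-bound (Cs i) (Gs i) (proj₁ (Gs-gen i)) (Gs∈C i) (Gs-cols i) (Cs-dist i) (ℕ.<⇒≤ h<n)

  G₀ : Fin k → Vec t
  G₀ = ⨁ Gs

  G₀-gen : IsGenMatrix L K C G₀
  G₀-gen = genMatrix-⨁ Cs Gs Gs-gen

  C-dist : MinDist L K C (n ∸ h)
  C-dist = directSum-minDist Cs Cs-sub Cs-dist

  maxDim : ∀ δ → δ ≤ k → ∃ (MaxDim G₀ δ)
  maxDim = maxDim-exists G₀

  maxDim-at : ∀ ρ → ∃ (MaxDim G₀ (k ∸ ρ))
  maxDim-at ρ = maxDim (k ∸ ρ) (ℕ.m∸n≤m k ρ)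

  E-small : ∀ {δ E} → MaxDim G₀ δ E → δ ≤ h → E ≤ δ
  E-small maxE = proj₁ (⨁-∩-bound h<n m Gs Gs-bound (proj₁ maxE))

  E-block : ∀ {δ E} → MaxDim G₀ δ E → δ ≡ suc h → E ≤ n
  E-block maxE = proj₂ (⨁-∩-bound h<n m Gs Gs-bound (proj₁ maxE))

  E-tail : ∀ s {δ E} → MaxDim G₀ δ E → (m ∸ s) ℕ.* suc h ≡ δ → (m ∸ s) ℕ.* n ≤ E
  E-tail s maxE δ≡ = proj₁ (proj₂ maxE) _ (≡.subst (λ δ → Achieves G₀ δ _) δ≡ (tail-achieves m s Gs Gs-cols))

  E-chain : ∀ {G δ E} d → IsGenMatrix L K C G → MaxDim G δ E → δ ℕ.+ d ≡ ℕ.pred k → E ℕ.+ d ℕ.+ (n ∸ h) ≤ t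
  E-chain {G} d G-gen maxE δ+d≡ = ∩-dim-bound C G (GenMatrix.rows-indep G-gen) (GenMatrix.lc∈C G-gen)
    (U-dim G (GenMatrix.columns-indep G-gen)) C-dist d δ+d≡ (proj₁ maxE)

  maxDim-of-GRW : ∀ ρ {w} → GRW L K C k ρ w → ∃ λ E → MaxDim G₀ (k ∸ ρ) E × E ℕ.+ w ≡ t
  maxDim-of-GRW ρ gr = let (E , maxE) = maxDim-at ρ in E , maxE , GRW-value {ρ = ρ} G₀-gen maxE gr

  GRW-of-maxDim : ∀ ρ {w E} → MaxDim G₀ (k ∸ ρ) E → E ℕ.+ w ≡ t → GRW L K C k ρ w
  GRW-of-maxDim ρ {w} {E} maxE E+w≡t =
    ≡.subst (GRW L K C k ρ) (≡.trans (≡.cong (_∸ E) (≡.sym E+w≡t)) (ℕ.m+n∸m≡n E w)) (MaxDim⇒GRW {ρ = ρ} G₀-gen maxE)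

  is-code : IsCodeP L K C k (n ∸ h)
  is-code = (directSum-subspace Cs Cs-sub ,
             G₀ , GenMatrix.rows∈C G₀-gen , GenMatrix.rows-indep G₀-gen , GenMatrix.C⊆span G₀-gen) , C-dist

  grw-exists : ∀ ρ → 1 ≤ ρ → ρ ≤ k → ∃ λ w → GRW L K C k ρ w
  grw-exists ρ _ _ = _ , MaxDim⇒GRW {ρ = ρ} G₀-gen (proj₂ (maxDim-at ρ))

  rows-indep : LL.Indep G₀
  rows-indep = GenMatrix.rows-indep G₀-gen

  h+2≤k : suc (suc h) ≤ k
  h+2≤k = ℕ.≤-trans (s≤s (ℕ.m≤n+m (suc h) h)) (ℕ.+-monoʳ-≤ (suc h) (ℕ.m≤m+n (suc h) (m″ ℕ.* suc h)))

  n≤E-block : ∀ {δ E} → MaxDim G₀ δ E → δ ≡ suc h → n ≤ E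
  n≤E-block maxE δ≡ = ≡.subst (_≤ _) (once n) (E-tail m′ maxE (≡.trans (once (suc h)) (≡.sym δ≡)))
    where
    once : ∀ x → (m ∸ m′) ℕ.* x ≡ x
    once x = ≡.trans (≡.cong (ℕ._* x) (1+m∸m≡1 m′)) (ℕ.*-identityˡ x)

  grw-low : ∀ i → 1 ≤ i → i ≤ suc h → GRW L K C k i (n ∸ h ∸ 1 ℕ.+ i)
  grw-low (suc i) 1≤i i<h = GRW-of-maxDim (suc i) maxE (low-weight h<n (ℕ.≤-pred i<h) lower upper)
    where
    E = proj₁ (maxDim-at (suc i))
    maxE = proj₂ (maxDim-at (suc i))
    upper : E ℕ.+ i ℕ.+ (n ∸ h) ≤ t
    upper = E-chain i G₀-gen maxE (1+m∸n+[n∸1]≡m 1≤i (ℕ.≤-trans i<h (ℕ.m≤m+n (suc h) (m′ ℕ.* suc h))))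
    split : (k ∸ suc h) ℕ.+ (h ∸ i) ≡ k ∸ suc i
    split = [o∸n]+[n∸m]≡o∸m i<h (ℕ.m≤m+n (suc h) (m′ ℕ.* suc h))
    maxE₁ = proj₂ (maxDim-at (suc h))
    lower : m′ ℕ.* n ℕ.+ (h ∸ i) ≤ E
    lower = ℕ.≤-trans (ℕ.+-monoˡ-≤ (h ∸ i) (E-tail 1 maxE₁ (≡.sym (ℕ.m+n∸m≡n (suc h) (m′ ℕ.* suc h)))))
      (maxDim-+ rows-indep (h ∸ i) (≡.subst (_≤ k) (≡.sym split) (ℕ.m∸n≤m k (suc i))) maxE₁
        (≡.subst (λ δ → MaxDim G₀ δ E) (≡.sym split) maxE))

  grw-high : ∀ i → i ≤ h → GRW L K C k (k ∸ i) (m ℕ.* n ∸ i)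
  grw-high i i≤h = GRW-of-maxDim (k ∸ i) maxE (≡.trans (≡.cong (ℕ._+ (t ∸ i)) E≡i) (ℕ.m+[n∸m]≡n i≤t))
    where
    i≤t : i ≤ t
    i≤t = ℕ.≤-trans i≤h (ℕ.≤-trans (ℕ.<⇒≤ h<n) (ℕ.m≤m+n n (m′ ℕ.* n)))
    δ≡i : k ∸ (k ∸ i) ≡ i
    δ≡i = ℕ.m∸[m∸n]≡n (ℕ.≤-trans i≤h (ℕ.≤-trans (ℕ.n≤1+n h) (ℕ.m≤m+n (suc h) (m′ ℕ.* suc h))))
    E = proj₁ (maxDim-at (k ∸ i))
    maxE = proj₂ (maxDim-at (k ∸ i))
    E≡i : E ≡ i
    E≡i = ℕ.≤-antisym (≡.subst (E ≤_) δ≡i (E-small maxE (≡.subst (_≤ h) (≡.sym δ≡i) i≤h)))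
      (≡.subst (_≤ E) δ≡i (ℕ.≤-trans (ℕ.m≤n+m _ _) (maxDim-+ rows-indep (k ∸ (k ∸ i)) (ℕ.m∸n≤m k (k ∸ i)) (proj₂ (maxDim 0 z≤n)) maxE)))

  grw-block : GRW L K C k (m′ ℕ.* suc h) (m′ ℕ.* n)
  grw-block = GRW-of-maxDim (m′ ℕ.* suc h) maxE (≡.cong (ℕ._+ m′ ℕ.* n) (ℕ.≤-antisym (E-block maxE δ≡) (n≤E-block maxE δ≡)))
    where
    maxE = proj₂ (maxDim-at (m′ ℕ.* suc h))
    δ≡ : k ∸ m′ ℕ.* suc h ≡ suc h
    δ≡ = ℕ.m+n∸n≡m (suc h) (m′ ℕ.* suc h)

  weight-h+2 : ∀ w → GRW L K C k (h ℕ.+ 2) w → n ℕ.+ 1 ≤ w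
  weight-h+2 w gr = let (E , maxE , E+w≡t) = maxDim-of-GRW (h ℕ.+ 2) gr in
    weight-above E+w≡t (E-chain (suc h) G₀-gen maxE δ+h≡k′) (ℕ.<⇒≤ h<n)
    where
    h+2∸1≡ : h ℕ.+ 2 ∸ 1 ≡ suc h
    h+2∸1≡ = ≡.trans (ℕ.+-∸-assoc h (s≤s z≤n)) (ℕ.+-comm h 1)
    δ+h≡k′ : (k ∸ (h ℕ.+ 2)) ℕ.+ suc h ≡ ℕ.pred k
    δ+h≡k′ = ≡.trans (≡.cong ((k ∸ (h ℕ.+ 2)) ℕ.+_) (≡.sym h+2∸1≡))
      (1+m∸n+[n∸1]≡m {n = h ℕ.+ 2} (ℕ.≤-trans (s≤s z≤n) (ℕ.m≤n+m 2 h)) (≡.subst (_≤ k) (ℕ.+-comm 2 h) h+2≤k))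

  weights-increase : ∀ ρ w w′ → h ℕ.+ 2 ≤ ρ → suc ρ ≤ m′ ℕ.* suc h ∸ 1 →
    GRW L K C k ρ w → GRW L K C k (suc ρ) w′ → w < w′
  weights-increase ρ w w′ _ ρ<k-h gr gr′ =
    let (E , maxE , E+w≡t) = maxDim-of-GRW ρ gr
        (E′ , maxE′ , E′+w′≡t) = maxDim-of-GRW (suc ρ) gr′
    in weight-increases E+w≡t E′+w′≡t (maxDim-suc rows-indep δ′<k maxE′ (≡.subst (λ δ → MaxDim G₀ δ E) (m∸n≡1+[m∸[1+n]] ρ<k) maxE))
    where
    ρ<k : ρ < k
    ρ<k = ℕ.≤-trans ρ<k-h (ℕ.≤-trans (ℕ.m∸n≤m (m′ ℕ.* suc h) 1) (ℕ.m≤n+m (m′ ℕ.* suc h) (suc h)))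
    δ′<k : k ∸ suc ρ < k
    δ′<k = ≡.subst (_≤ k) (m∸n≡1+[m∸[1+n]] ρ<k) (ℕ.m∸n≤m k ρ)

  weight-penultimate : ∀ w → GRW L K C k (m′ ℕ.* suc h ∸ 1) w → w ≤ m′ ℕ.* n ∸ 1
  weight-penultimate w gr = let (E , maxE , E+w≡t) = maxDim-of-GRW (m′ ℕ.* suc h ∸ 1) gr in weight-below-pred E+w≡t (n<E maxE)
    where
    n<E : ∀ {E} → MaxDim G₀ (k ∸ (m′ ℕ.* suc h ∸ 1)) E → suc n ≤ E
    n<E {E} maxE = let (E₁ , maxE₁) = maxDim (suc h) (ℕ.m≤m+n (suc h) (m′ ℕ.* suc h)) in
      ℕ.≤-trans (s≤s (n≤E-block maxE₁ ≡.refl))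
        (maxDim-suc rows-indep h+2≤k maxE₁ (≡.subst (λ δ → MaxDim G₀ δ E) (m+n∸[n∸1]≡1+m (suc h) {m′ ℕ.* suc h} (s≤s z≤n)) maxE))

  weight-tail : ∀ j → 1 ≤ j → j ≤ m′ → ∀ w → GRW L K C k (j ℕ.* suc h) w → w ≤ j ℕ.* n
  weight-tail j _ j≤m′ w gr = let (E , maxE , E+w≡t) = maxDim-of-GRW (j ℕ.* suc h) gr in
    weight-below E+w≡t (E-tail j maxE (ℕ.*-distribʳ-∸ (suc h) m j)) (ℕ.m≤n⇒m≤1+n j≤m′)

open Data.Nat using (_+_; _*_)

proposition4p4 :
  (q m h n : ℕ) → IsPrimePower q → 2 ≤ m → 1 ≤ h → h + 1 ≤ n →
  (L : Field) (K : Scalars L) → IsExtension L K q n →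
  (Cs : Fin m → V L n → Set) →
  (∀ i → IsMRD L K n (Cs i) (h + 1) (n ∸ h)) →
  let C = DirectSum L Cs
      k = m * (h + 1)
  in IsCodeP L K C k (n ∸ h)
     × (∀ ρ → 1 ≤ ρ → ρ ≤ k → ∃ λ w → GRW L K C k ρ w)
     × (∀ i → 1 ≤ i → i ≤ h + 1 → GRW L K C k i (n ∸ h ∸ 1 + i))
     × (∀ i → i ≤ h → GRW L K C k (k ∸ i) (m * n ∸ i))
     × GRW L K C k ((m ∸ 1) * (h + 1)) ((m ∸ 1) * n)
     × (2 < m →
         (∀ w → GRW L K C k (h + 2) w → n + 1 ≤ w)
         × (∀ ρ w w' → h + 2 ≤ ρ → suc ρ ≤ (m ∸ 1) * (h + 1) ∸ 1 →
              GRW L K C k ρ w → GRW L K C k (suc ρ) w' → w < w')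
         × (∀ w → GRW L K C k ((m ∸ 1) * (h + 1) ∸ 1) w → w ≤ (m ∸ 1) * n ∸ 1)
         × (∀ j → 1 ≤ j → j ≤ m ∸ 1 → ∀ w → GRW L K C k (j * (h + 1)) w → w ≤ j * n))
proposition4p4 q zero h n _ ()
proposition4p4 q (suc zero) h n _ (s≤s ())
proposition4p4 q (suc (suc m″)) h n _ _ _ rewrite ℕ.+-comm h 1 = λ h<n L K ext Cs Cs-MRD →
  let open DirectSumOfMRD m″ h n h<n L K q ext Cs Cs-MRD in
  is-code , grw-exists , grw-low , grw-high , grw-block ,
  λ _ → weight-h+2 , weights-increase , weight-penultimate , weight-tail
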